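{- Let $\beta$ be odd and let $\mathcal C=\langle (b\mid 0),(\ell\mid fh+2f)\rangle$ be a $\mathbb{Z}_2\mathbb{Z}_4$-additive cyclic code of type $(\alpha,\beta;\gamma,\delta;\kappa)$, where $f,g,h\in\mathbb{Z}_4[x]$ are monic pairwise coprime with $fgh=x^\beta-1$, $b,\ell\in\mathbb{Z}_2[x]$, $b\mid x^\alpha-1$, $\deg(\ell)<\deg(b)$, and $b$ divides $\frac{x^\beta-1}{f}\ell\pmod 2$. Let its dual be written $\mathcal C^\perp=\langle(\bar b\mid 0),(\bar\ell\mid\bar f\bar h+2\bar f)\rangle$ in the same form. Then $$\bar b=\frac{x^\alpha-1}{(\gcd(b,\ell))^*}\in\mathbb{Z}_2[x].$$
   Context: A $\mathbb{Z}_2\mathbb{Z}_4$-additive cyclic code is a subgroup of $\mathbb{Z}_2^\alpha\times\mathbb{Z}_4^\beta$ invariant under simultaneously cyclically shifting binary and quaternary coordinates; these are identified with $\mathbb{Z}_4[x]$-submodules of $R_{\alpha,\beta}=\mathbb{Z}_2[x]/(x^\alpha-1)\times\mathbb{Z}_4[x]/(x^\beta-1)$ under $\lambda\star(p\mid q)=(\lambda p\bmod2\mid\lambda q)$, and every one can be written as $\langle(b\mid0),(\ell\mid fh+2f)\rangle$ with the stated conditions. The dual is taken with respect to $\mathbf u\cdot\mathbf v=2\sum_iu_iv_i+\sum_ju'_jv'_j\in\mathbb{Z}_4$ and is again cyclic. Type: $\mathcal C\cong\mathbb{Z}_2^\gamma\times\mathbb{Z}_4^\delta$, $\kappa$ the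 dimension of the binary projection of the order-$\le2$ subcode. $p^*(x)=x^{\deg p}p(x^{ -1})$; gcd in $\mathbb{Z}_2[x]$. -}

module Defs where

open import Data.Nat as ℕ using (ℕ; zero; suc; _<_; _∸_)
open import Data.Nat.DivMod using (_mod_)
open import Data.Fin as F using (Fin; zero; suc; toℕ; fromℕ; inject₁)
open import Data.List using (List; []; _∷_; _++_; length; reverse; replicate)
open import Data.Product using (Σ; _×_; _,_)
open import Relation.Nullary using (yes; no)
open import Relation.Binary.PropositionalEquality using (_≡_)

-- Arithmetic in ℤ_(m+1), carrier Fin (suc m)

module Arith (m : ℕ) where
  Z : Set
  Z = Fin (suc m)

  0# : Z
  0# = zero

  1# : Z
  1# = 1 mod suc m

  infixl 6 _+_
  infixl 7 _*_
  _+_ : Z → Z → Z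
  a + b = (toℕ a ℕ.+ toℕ b) mod suc m

  _*_ : Z → Z → Z
  a * b = (toℕ a ℕ.* toℕ b) mod suc m

  -_ : Z → Z
  - a = (suc m ∸ toℕ a) mod suc m

  sumV : ∀ n → (Fin n → Z) → Z
  sumV zero    v = 0#
  sumV (suc n) v = v zero + sumV n (λ i → v (suc i))

-- Polynomials over ℤ_(m+1) as coefficient lists (constant term first)

module Poly (m : ℕ) where
  open Arith m public

  Pol : Set
  Pol = List Z

  infixl 6 _⊕_
  infixl 7 _⊛_
  _⊕_ : Pol → Pol → Pol
  []       ⊕ q        = q
  (a ∷ p)  ⊕ []       = a ∷ p
  (a ∷ p)  ⊕ (b ∷ q)  = (a + b) ∷ (p ⊕ q)

  scale : Z → Pol → Pol
  scale a []      = []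
  scale a (b ∷ q) = (a * b) ∷ scale a q

  _⊛_ : Pol → Pol → Pol
  []      ⊛ q = []
  (a ∷ p) ⊛ q = scale a q ⊕ (0# ∷ (p ⊛ q))

  const : Z → Pol
  const a = a ∷ []

  strip : Pol → Pol
  strip []      = []
  strip (a ∷ p) with strip p
  ... | b ∷ r = a ∷ b ∷ r
  ... | [] with a F.≟ 0#
  ...   | yes _ = []
  ...   | no  _ = a ∷ []

  infix 4 _≈_
  _≈_ : Pol → Pol → Set
  p ≈ q = strip p ≡ strip q

  infix 4 _∣_
  _∣_ : Pol → Pol → Set
  d ∣ p = Σ Pol λ q → q ⊛ d ≈ p

  -- deg p < deg q  (with deg 0 = -∞)
  DegLt : Pol → Pol → Set
  DegLt p q = length (strip p) < length (strip q)

  Monic : Pol → Set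
  Monic p = Σ Pol λ r → strip p ≡ r ++ (1# ∷ [])

  Coprime : Pol → Pol → Set
  Coprime p q = Σ Pol λ u → Σ Pol λ v → u ⊛ p ⊕ v ⊛ q ≈ const 1#

  IsGCD : Pol → Pol → Pol → Set
  IsGCD d p q = (d ∣ p) × (d ∣ q) × (∀ e → e ∣ p → e ∣ q → e ∣ d)

  -- reciprocal p*(x) = x^deg p · p(1/x)
  _* : Pol → Pol
  p * = reverse (strip p)

  xⁿ-1 : ℕ → Pol
  xⁿ-1 n = const (- 1#) ⊕ (replicate n 0# ++ (1# ∷ []))

  -- reduction modulo x^n - 1, as a vector of length n
  prev : ∀ {n} → Fin n → Fin n
  prev {suc k} zero    = fromℕ k
  prev {suc k} (suc j) = inject₁ j

  addAt0 : ∀ {n} → Z → (Fin n → Z) → Fin n → Z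
  addAt0 a v zero    = a + v zero
  addAt0 a v (suc j) = v (suc j)

  vec : ∀ n → Pol → Fin n → Z
  vec n []      = λ _ → 0#
  vec n (a ∷ p) = addAt0 a (λ j → vec n p (prev j))

module P2 = Poly 1
module P4 = Poly 3

red₂ : Fin 4 → Fin 2
red₂ a = toℕ a mod 2

red₂ₚ : P4.Pol → P2.Pol
red₂ₚ []      = []
red₂ₚ (a ∷ p) = red₂ a ∷ red₂ₚ p

ι : Fin 2 → Fin 4
ι a = F.inject≤ a (ℕ.s≤s (ℕ.s≤s ℕ.z≤n))

two₄ : Fin 4
two₄ = suc (suc zero)

Word : ℕ → ℕ → Set
Word α β = (Fin α → Fin 2) × (Fin β → Fin 4)

_≈w_ : ∀ {α β} → Word α β → Word α β → Set
(u , u') ≈w (v , v') = (∀ i → u i ≡ v i) × (∀ j → u' j ≡ v' j)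

Code : ℕ → ℕ → Set₁
Code α β = Word α β → Set

inner : ∀ {α β} → Word α β → Word α β → Fin 4
inner {α} {β} (u , u') (v , v') =
  P4.sumV α (λ i → two₄ P4.* (ι (u i) P4.* ι (v i))) P4.+ P4.sumV β (λ j → u' j P4.* v' j)

Dual : ∀ {α β} → Code α β → Code α β
Dual C w = ∀ u → C u → inner u w ≡ zero

-- λ ⋆ (b | 0) + μ ⋆ (ℓ | F)  viewed as a word of ℤ₂^α × ℤ₄^β
genWord : ∀ α β → (b ℓ : P2.Pol) (F λ' μ : P4.Pol) → Word α β
genWord α β b ℓ F λ' μ =
  P2.vec α ((red₂ₚ λ' P2.⊛ b) P2.⊕ (red₂ₚ μ P2.⊛ ℓ)) , P4.vec β (μ P4.⊛ F)

Gen : ∀ α β → (b ℓ : P2.Pol) (F : P4.Pol) → Code α β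
Gen α β b ℓ F w = Σ P4.Pol λ λ' → Σ P4.Pol λ μ → w ≈w genWord α β b ℓ F λ' μ

genF : P4.Pol → P4.Pol → P4.Pol
genF f h = (f P4.⊛ h) P4.⊕ P4.scale two₄ f

StdForm : ∀ α β → (b ℓ : P2.Pol) (f g h : P4.Pol) → Set
StdForm α β b ℓ f g h =
  P4.Monic f × P4.Monic g × P4.Monic h ×
  P4.Coprime f g × P4.Coprime f h × P4.Coprime g h ×
  (f P4.⊛ g P4.⊛ h P4.≈ P4.xⁿ-1 β) ×
  (b P2.∣ P2.xⁿ-1 α) ×
  P2.DegLt ℓ b ×
  (∀ q → q P4.⊛ f P4.≈ P4.xⁿ-1 β → b P2.∣ (red₂ₚ q P2.⊛ ℓ))

module Submission where

-- For C = ⟨(b | 0), (ℓ | fh + 2f)⟩ with dual C̄ = ⟨(b̄ | 0), (ℓ̄ | f̄h̄ + 2f̄)⟩ and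
-- d = gcd(b, ℓ) we prove b̄·d* = x^α − 1, looking only at binary words (V | 0):
-- their ℤ₄ inner product with C is twice a cyclic binary inner product, and V is
-- orthogonal to all cyclic shifts of p iff x^α − 1 divides p·V*.
--  (1) (b̄ | 0) ∈ C̄ = C^⊥, so x^α − 1 divides b·b̄* and ℓ·b̄*; writing
--      x^α − 1 = c̄·b̄, the reciprocal c̄* divides b and ℓ, hence d.
--  (2) If x^α − 1 = e·d then D = e* has D·d* = x^α − 1, so (D | 0) ⊥ C and
--      (D | 0) ∈ C̄; binary words of a code in standard form are multiples of its
--      binary generator (a kernel computation in ℤ₄[x]), so b̄ divides D.
--  (3) Then c̄·b̄ = D·d* = (s·b̄)(t*·c̄) forces s·t* = 1 in ℤ₂[x], so D = b̄.

open import Defs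
open import Data.Nat using (ℕ; _≤_; _%_)
open import Data.Product using (_×_; Σ)
open import Relation.Binary.PropositionalEquality using (_≡_)
open import Function.Bundles using (_⇔_)

open import Data.Nat as ℕ using (zero; suc; _<_; z≤n; s≤s)
import Data.Nat.Properties as ℕP
open import Data.Nat.DivMod using (_mod_; m%n<n; m<n⇒m%n≡m; m≤n⇒m%n≡m; %-distribˡ-+; m%n%n≡m%n; [m+n]%n≡m%n)
open import Data.Fin as F using (Fin; zero; suc; toℕ; fromℕ; inject₁)
open import Data.Fin.Properties using (toℕ-injective; toℕ-fromℕ<; toℕ-fromℕ; toℕ-inject₁; toℕ<n; all?) renaming (_≟_ to _≟ᶠ_)
open import Data.List using ([]; _∷_; _++_; length; reverse; replicate; map)
open import Data.List.Properties using (unfold-reverse; length-reverse; reverse-++; reverse-involutive; length-++)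
open import Data.Product using (_,_; proj₁; proj₂)
open import Data.Sum using (_⊎_; inj₁; inj₂)
open import Data.Empty using (⊥-elim)
import Data.Maybe
open import Relation.Nullary using (¬_; yes; no; Dec; ¬?)
open import Relation.Nullary.Decidable using (True; toWitness)
open import Relation.Binary.PropositionalEquality using (refl; sym; trans; cong; cong₂; subst; subst₂; module ≡-Reasoning)
open import Relation.Binary.Bundles using (Setoid)
import Relation.Binary.Reasoning.Setoid as SR
open import Function.Bundles using (Equivalence)
open import Algebra.Bundles using (CommutativeRing)
import Tactic.RingSolver.Core.AlmostCommutativeRing as ACR
import Tactic.RingSolver.NonReflective as NR
open import Tactic.RingSolver.Core.Expression using () renaming (_⊕_ to _:+_; _⊗_ to _:*_; ⊝_ to :-_)

record CommRingLaws (m : ℕ) : Set where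
  open Arith m
  field
    +-assoc : ∀ a b c → (a + b) + c ≡ a + (b + c)
    +-comm : ∀ a b → a + b ≡ b + a
    +-idˡ : ∀ a → 0# + a ≡ a
    *-assoc : ∀ a b c → (a * b) * c ≡ a * (b * c)
    *-comm : ∀ a b → a * b ≡ b * a
    *-idˡ : ∀ a → 1# * a ≡ a
    *-zeroˡ : ∀ a → 0# * a ≡ 0#
    distribˡ : ∀ a b c → a * (b + c) ≡ (a * b) + (a * c)
    neg-inv : ∀ a → a + ((- 1#) * a) ≡ 0#
    1≢0 : ¬ (1# ≡ 0#)

-- Equations between functions of finitely many variables over finite sets are
-- decidable, so each such identity is established by evaluating its decision.
Eq₁? : ∀ {n k} (f g : Fin n → Fin k) → Dec (∀ a → f a ≡ g a)
Eq₁? f g = all? λ a → f a ≟ᶠ g a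

Eq₂? : ∀ {n n' k} (f g : Fin n → Fin n' → Fin k) → Dec (∀ a b → f a b ≡ g a b)
Eq₂? f g = all? λ a → Eq₁? (f a) (g a)

Eq₃? : ∀ {n n' n'' k} (f g : Fin n → Fin n' → Fin n'' → Fin k) → Dec (∀ a b c → f a b c ≡ g a b c)
Eq₃? f g = all? λ a → Eq₂? (f a) (g a)

lawsByEvaluation : (m : ℕ) → let open Arith m in
  {+-assoc : True (Eq₃? (λ a b c → (a + b) + c) (λ a b c → a + (b + c)))}
  {+-comm : True (Eq₂? _+_ (λ a b → b + a))}
  {+-idˡ : True (Eq₁? (0# +_) (λ a → a))}
  {*-assoc : True (Eq₃? (λ a b c → (a * b) * c) (λ a b c → a * (b * c)))}
  {*-comm : True (Eq₂? _*_ (λ a b → b * a))}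
  {*-idˡ : True (Eq₁? (1# *_) (λ a → a))}
  {*-zeroˡ : True (Eq₁? (0# *_) (λ _ → 0#))}
  {distribˡ : True (Eq₃? (λ a b c → a * (b + c)) (λ a b c → (a * b) + (a * c)))}
  {neg-inv : True (Eq₁? (λ a → a + ((- 1#) * a)) (λ _ → 0#))}
  {1≢0 : True (¬? (1# ≟ᶠ 0#))} →
  CommRingLaws m
lawsByEvaluation m {p₁} {p₂} {p₃} {p₄} {p₅} {p₆} {p₇} {p₈} {p₉} {p₁₀} = record
  { +-assoc = toWitness p₁ ; +-comm = toWitness p₂ ; +-idˡ = toWitness p₃
  ; *-assoc = toWitness p₄ ; *-comm = toWitness p₅ ; *-idˡ = toWitness p₆
  ; *-zeroˡ = toWitness p₇ ; distribˡ = toWitness p₈ ; neg-inv = toWitness p₉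
  ; 1≢0 = toWitness p₁₀ }

ℤ₂-laws : CommRingLaws 1
ℤ₂-laws = lawsByEvaluation 1

ℤ₄-laws : CommRingLaws 3
ℤ₄-laws = lawsByEvaluation 3

module PolyArithmetic (m : ℕ) (L : CommRingLaws m) where
  open Poly m public
  open CommRingLaws L public

  +-idʳ : ∀ a → a + 0# ≡ a
  +-idʳ a = trans (+-comm a 0#) (+-idˡ a)
  *-zeroʳ : ∀ a → a * 0# ≡ 0#
  *-zeroʳ a = trans (*-comm a 0#) (*-zeroˡ a)
  *-idʳ : ∀ a → a * 1# ≡ a
  *-idʳ a = trans (*-comm a 1#) (*-idˡ a)
  distribʳ : ∀ a b c → (b + c) * a ≡ (b * a) + (c * a)
  distribʳ a b c = trans (*-comm (b + c) a) (trans (distribˡ a b c) (cong₂ _+_ (*-comm a b) (*-comm a c)))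

  coeff : Pol → ℕ → Z
  coeff [] n = 0#
  coeff (a ∷ p) zero = a
  coeff (a ∷ p) (suc n) = coeff p n

  infix 4 _~_
  record _~_ (p q : Pol) : Set where
    constructor mk~
    field un~ : ∀ n → coeff p n ≡ coeff q n
  open _~_ public

  ~-refl : ∀ {p} → p ~ p
  ~-refl = mk~ λ n → refl
  ~-sym : ∀ {p q} → p ~ q → q ~ p
  ~-sym e = mk~ λ n → sym (un~ e n)
  ~-trans : ∀ {p q r} → p ~ q → q ~ r → p ~ r
  ~-trans e f = mk~ λ n → trans (un~ e n) (un~ f n)

  ~-setoid : Setoid _ _
  ~-setoid = record { Carrier = Pol ; _≈_ = _~_ ; isEquivalence = record { refl = λ {p} → ~-refl {p} ; sym = λ {p} {q} → ~-sym {p} {q} ; trans = λ {p} {q} {r} → ~-trans {p} {q} {r} } }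

  ∷-cong : ∀ {a b p q} → a ≡ b → p ~ q → (a ∷ p) ~ (b ∷ q)
  ∷-cong e f = mk~ λ { zero → e ; (suc n) → un~ f n }

  ∷-inv : ∀ {a b p q} → (a ∷ p) ~ (b ∷ q) → (a ≡ b) × (p ~ q)
  ∷-inv e = un~ e zero , mk~ λ n → un~ e (suc n)

  coeff-⊕ : ∀ p q n → coeff (p ⊕ q) n ≡ coeff p n + coeff q n
  coeff-⊕ [] q n = sym (+-idˡ (coeff q n))
  coeff-⊕ (a ∷ p) [] n = sym (+-idʳ (coeff (a ∷ p) n))
  coeff-⊕ (a ∷ p) (b ∷ q) zero = refl
  coeff-⊕ (a ∷ p) (b ∷ q) (suc n) = coeff-⊕ p q n

  coeff-scale : ∀ a p n → coeff (scale a p) n ≡ a * coeff p n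
  coeff-scale a [] n = sym (*-zeroʳ a)
  coeff-scale a (b ∷ p) zero = refl
  coeff-scale a (b ∷ p) (suc n) = coeff-scale a p n

  ⊕-cong : ∀ {p p' q q'} → p ~ p' → q ~ q' → p ⊕ q ~ p' ⊕ q'
  ⊕-cong {p} {p'} {q} {q'} e f = mk~ λ n → trans (coeff-⊕ p q n) (trans (cong₂ _+_ (un~ e n) (un~ f n)) (sym (coeff-⊕ p' q' n)))

  scale-cong : ∀ {a b p q} → a ≡ b → p ~ q → scale a p ~ scale b q
  scale-cong {a} {b} {p} {q} e f = mk~ λ n → trans (coeff-scale a p n) (trans (cong₂ _*_ e (un~ f n)) (sym (coeff-scale b q n)))

  ⊕-comm : ∀ p q → p ⊕ q ~ q ⊕ p
  ⊕-comm p q = mk~ λ n → trans (coeff-⊕ p q n) (trans (+-comm (coeff p n) (coeff q n)) (sym (coeff-⊕ q p n)))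

  ⊕-assoc : ∀ p q r → (p ⊕ q) ⊕ r ~ p ⊕ (q ⊕ r)
  ⊕-assoc p q r = mk~ λ n → trans (coeff-⊕ (p ⊕ q) r n) (trans (cong (_+ coeff r n) (coeff-⊕ p q n))
    (trans (+-assoc (coeff p n) (coeff q n) (coeff r n)) (trans (cong (coeff p n +_) (sym (coeff-⊕ q r n))) (sym (coeff-⊕ p (q ⊕ r) n)))))

  ⊕-idˡ : ∀ p → [] ⊕ p ~ p
  ⊕-idˡ p = mk~ λ n → refl
  ⊕-idʳ : ∀ p → p ⊕ [] ~ p
  ⊕-idʳ p = mk~ λ n → trans (coeff-⊕ p [] n) (+-idʳ (coeff p n))

  scale-⊕ : ∀ a p q → scale a (p ⊕ q) ~ scale a p ⊕ scale a q
  scale-⊕ a p q = mk~ λ n → trans (coeff-scale a (p ⊕ q) n) (trans (cong (a *_) (coeff-⊕ p q n))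
    (trans (distribˡ a (coeff p n) (coeff q n)) (trans (cong₂ _+_ (sym (coeff-scale a p n)) (sym (coeff-scale a q n))) (sym (coeff-⊕ (scale a p) (scale a q) n)))))

  scale-+ : ∀ a b p → scale (a + b) p ~ scale a p ⊕ scale b p
  scale-+ a b p = mk~ λ n → trans (coeff-scale (a + b) p n) (trans (distribʳ (coeff p n) a b) (trans (cong₂ _+_ (sym (coeff-scale a p n)) (sym (coeff-scale b p n))) (sym (coeff-⊕ (scale a p) (scale b p) n))))

  scale-scale : ∀ a b p → scale a (scale b p) ~ scale (a * b) p
  scale-scale a b p = mk~ λ n → trans (coeff-scale a (scale b p) n) (trans (cong (a *_) (coeff-scale b p n)) (trans (sym (*-assoc a b (coeff p n))) (sym (coeff-scale (a * b) p n))))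

  scale-0 : ∀ p → scale 0# p ~ []
  scale-0 p = mk~ λ n → trans (coeff-scale 0# p n) (*-zeroˡ (coeff p n))

  scale-1 : ∀ p → scale 1# p ~ p
  scale-1 p = mk~ λ n → trans (coeff-scale 1# p n) (*-idˡ (coeff p n))

  ⊛-zeroˡ : ∀ p q → p ~ [] → p ⊛ q ~ []
  ⊛-zeroˡ [] q e = ~-refl
  ⊛-zeroˡ (a ∷ p) q e = ~-trans (⊕-cong (~-trans (scale-cong (un~ e zero) ~-refl) (scale-0 q)) (∷-cong refl (⊛-zeroˡ p q (mk~ λ n → un~ e (suc n))))) z
    where
    z : [] ⊕ (0# ∷ []) ~ []
    z = mk~ λ { zero → refl ; (suc n) → refl }

  ⊛-congˡ : ∀ {p p'} q → p ~ p' → p ⊛ q ~ p' ⊛ q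
  ⊛-congˡ {[]} {p'} q e = ~-sym (⊛-zeroˡ p' q (~-sym e))
  ⊛-congˡ {a ∷ p} {[]} q e = ⊛-zeroˡ (a ∷ p) q e
  ⊛-congˡ {a ∷ p} {a' ∷ p'} q e = ⊕-cong (scale-cong (un~ e zero) ~-refl) (∷-cong refl (⊛-congˡ {p} {p'} q (mk~ λ n → un~ e (suc n))))

  ⊛-congʳ : ∀ p {q q'} → q ~ q' → p ⊛ q ~ p ⊛ q'
  ⊛-congʳ [] e = ~-refl
  ⊛-congʳ (a ∷ p) e = ⊕-cong (scale-cong refl e) (∷-cong refl (⊛-congʳ p e))

  ⊛-cong : ∀ {p p' q q'} → p ~ p' → q ~ q' → p ⊛ q ~ p' ⊛ q'
  ⊛-cong {p} {p'} {q} {q'} e f = ~-trans (⊛-congˡ q e) (⊛-congʳ p' f)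

  x⊕ : ∀ a p → (a ∷ p) ~ (a ∷ []) ⊕ (0# ∷ p)
  x⊕ a p = mk~ λ { zero → sym (+-idʳ a) ; (suc n) → refl }

  ⊕-interchange : ∀ w x y z → (w ⊕ x) ⊕ (y ⊕ z) ~ (w ⊕ y) ⊕ (x ⊕ z)
  ⊕-interchange w x y z = begin
      (w ⊕ x) ⊕ (y ⊕ z) ≈⟨ ⊕-assoc w x (y ⊕ z) ⟩
      w ⊕ (x ⊕ (y ⊕ z)) ≈⟨ ⊕-cong (~-refl {w}) (~-sym (⊕-assoc x y z)) ⟩
      w ⊕ ((x ⊕ y) ⊕ z) ≈⟨ ⊕-cong (~-refl {w}) (⊕-cong (⊕-comm x y) (~-refl {z})) ⟩
      w ⊕ ((y ⊕ x) ⊕ z) ≈⟨ ⊕-cong (~-refl {w}) (⊕-assoc y x z) ⟩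
      w ⊕ (y ⊕ (x ⊕ z)) ≈⟨ ~-sym (⊕-assoc w y (x ⊕ z)) ⟩
      (w ⊕ y) ⊕ (x ⊕ z) ∎
    where open SR ~-setoid

  ⊛-distribʳ : ∀ p p' q → (p ⊕ p') ⊛ q ~ (p ⊛ q) ⊕ (p' ⊛ q)
  ⊛-distribʳ [] p' q = ~-refl
  ⊛-distribʳ (a ∷ p) [] q = ~-sym (⊕-idʳ _)
  ⊛-distribʳ (a ∷ p) (b ∷ p') q = begin
      scale (a + b) q ⊕ (0# ∷ ((p ⊕ p') ⊛ q)) ≈⟨ ⊕-cong (scale-+ a b q) (∷-cong (sym (+-idˡ 0#)) (⊛-distribʳ p p' q)) ⟩
      (scale a q ⊕ scale b q) ⊕ ((0# ∷ (p ⊛ q)) ⊕ (0# ∷ (p' ⊛ q))) ≈⟨ ⊕-interchange (scale a q) (scale b q) (0# ∷ (p ⊛ q)) (0# ∷ (p' ⊛ q)) ⟩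
      (scale a q ⊕ (0# ∷ (p ⊛ q))) ⊕ (scale b q ⊕ (0# ∷ (p' ⊛ q))) ∎
    where open SR ~-setoid

  ⊛-distribˡ : ∀ q p p' → q ⊛ (p ⊕ p') ~ (q ⊛ p) ⊕ (q ⊛ p')
  ⊛-distribˡ [] p p' = mk~ λ n → sym (+-idˡ 0#)
  ⊛-distribˡ (a ∷ q) p p' = begin
      scale a (p ⊕ p') ⊕ (0# ∷ (q ⊛ (p ⊕ p'))) ≈⟨ ⊕-cong (scale-⊕ a p p') (∷-cong (sym (+-idˡ 0#)) (⊛-distribˡ q p p')) ⟩
      (scale a p ⊕ scale a p') ⊕ ((0# ∷ (q ⊛ p)) ⊕ (0# ∷ (q ⊛ p'))) ≈⟨ ⊕-interchange (scale a p) (scale a p') (0# ∷ (q ⊛ p)) (0# ∷ (q ⊛ p')) ⟩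
      (scale a p ⊕ (0# ∷ (q ⊛ p))) ⊕ (scale a p' ⊕ (0# ∷ (q ⊛ p'))) ∎
    where open SR ~-setoid

  scale-⊛ˡ : ∀ a p q → scale a p ⊛ q ~ scale a (p ⊛ q)
  scale-⊛ˡ a [] q = mk~ λ n → sym (trans (coeff-scale a [] n) (*-zeroʳ a))
  scale-⊛ˡ a (b ∷ p) q = begin
      scale (a * b) q ⊕ (0# ∷ (scale a p ⊛ q)) ≈⟨ ⊕-cong (~-sym (scale-scale a b q)) (∷-cong (sym (*-zeroʳ a)) (scale-⊛ˡ a p q)) ⟩
      scale a (scale b q) ⊕ scale a (0# ∷ (p ⊛ q)) ≈⟨ ~-sym (scale-⊕ a (scale b q) (0# ∷ (p ⊛ q))) ⟩
      scale a (scale b q ⊕ (0# ∷ (p ⊛ q))) ∎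
    where open SR ~-setoid

  scale-⊛ʳ : ∀ a p q → p ⊛ scale a q ~ scale a (p ⊛ q)
  scale-⊛ʳ a [] q = mk~ λ n → sym (trans (coeff-scale a [] n) (*-zeroʳ a))
  scale-⊛ʳ a (b ∷ p) q = begin
      scale b (scale a q) ⊕ (0# ∷ (p ⊛ scale a q)) ≈⟨ ⊕-cong (~-trans (scale-scale b a q) (~-trans (scale-cong (*-comm b a) ~-refl) (~-sym (scale-scale a b q)))) (∷-cong (sym (*-zeroʳ a)) (scale-⊛ʳ a p q)) ⟩
      scale a (scale b q) ⊕ scale a (0# ∷ (p ⊛ q)) ≈⟨ ~-sym (scale-⊕ a (scale b q) (0# ∷ (p ⊛ q))) ⟩
      scale a (scale b q ⊕ (0# ∷ (p ⊛ q))) ∎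
    where open SR ~-setoid

  x-⊛ˡ : ∀ p q → (0# ∷ p) ⊛ q ~ 0# ∷ (p ⊛ q)
  x-⊛ˡ p q = ~-trans (⊕-cong (scale-0 q) (~-refl {0# ∷ (p ⊛ q)})) (⊕-idˡ _)

  x-⊛ʳ : ∀ p q → p ⊛ (0# ∷ q) ~ 0# ∷ (p ⊛ q)
  x-⊛ʳ [] q = mk~ λ { zero → refl ; (suc n) → refl }
  x-⊛ʳ (a ∷ p) q = mk~ λ { zero → trans (cong (_+ 0#) (*-zeroʳ a)) (+-idˡ 0#)
    ; (suc n) → trans (coeff-⊕ (scale a q) (p ⊛ (0# ∷ q)) n) (trans (cong (coeff (scale a q) n +_) (un~ (x-⊛ʳ p q) n)) (sym (coeff-⊕ (scale a q) (0# ∷ (p ⊛ q)) n))) }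

  ⊛-const : ∀ a q → (a ∷ []) ⊛ q ~ scale a q
  ⊛-const a q = ~-trans (⊕-cong (~-refl {scale a q}) z) (⊕-idʳ (scale a q))
    where
    z : (0# ∷ []) ~ []
    z = mk~ λ { zero → refl ; (suc n) → refl }

  ⊛-constʳ : ∀ a q → q ⊛ (a ∷ []) ~ scale a q
  ⊛-constʳ a [] = ~-refl
  ⊛-constʳ a (b ∷ q) = begin
      (b * a ∷ []) ⊕ (0# ∷ (q ⊛ (a ∷ []))) ≈⟨ ⊕-cong (~-refl {b * a ∷ []}) (∷-cong refl (⊛-constʳ a q)) ⟩
      (b * a ∷ []) ⊕ (0# ∷ scale a q) ≈⟨ ~-sym (x⊕ (b * a) (scale a q)) ⟩
      (b * a ∷ scale a q) ≈⟨ ∷-cong (*-comm b a) ~-refl ⟩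
      scale a (b ∷ q) ∎
    where open SR ~-setoid

  ⊛-zeroʳ : ∀ p → p ⊛ [] ~ []
  ⊛-zeroʳ [] = ~-refl
  ⊛-zeroʳ (a ∷ p) = mk~ λ { zero → refl ; (suc n) → un~ (⊛-zeroʳ p) n }

  ⊛-comm : ∀ p q → p ⊛ q ~ q ⊛ p
  ⊛-comm [] q = ~-sym (⊛-zeroʳ q)
  ⊛-comm (a ∷ p) q = begin
      scale a q ⊕ (0# ∷ (p ⊛ q)) ≈⟨ ⊕-cong (~-sym (⊛-constʳ a q)) (∷-cong refl (⊛-comm p q)) ⟩
      (q ⊛ (a ∷ [])) ⊕ (0# ∷ (q ⊛ p)) ≈⟨ ⊕-cong (~-refl {q ⊛ (a ∷ [])}) (~-sym (x-⊛ʳ q p)) ⟩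
      (q ⊛ (a ∷ [])) ⊕ (q ⊛ (0# ∷ p)) ≈⟨ ~-sym (⊛-distribˡ q _ _) ⟩
      q ⊛ ((a ∷ []) ⊕ (0# ∷ p)) ≈⟨ ⊛-congʳ q (~-sym (x⊕ a p)) ⟩
      q ⊛ (a ∷ p) ∎
    where open SR ~-setoid

  ⊛-assoc : ∀ p q r → (p ⊛ q) ⊛ r ~ p ⊛ (q ⊛ r)
  ⊛-assoc [] q r = ~-refl
  ⊛-assoc (a ∷ p) q r = begin
      (scale a q ⊕ (0# ∷ (p ⊛ q))) ⊛ r ≈⟨ ⊛-distribʳ (scale a q) (0# ∷ (p ⊛ q)) r ⟩
      (scale a q ⊛ r) ⊕ ((0# ∷ (p ⊛ q)) ⊛ r) ≈⟨ ⊕-cong (scale-⊛ˡ a q r) (x-⊛ˡ (p ⊛ q) r) ⟩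
      scale a (q ⊛ r) ⊕ (0# ∷ ((p ⊛ q) ⊛ r)) ≈⟨ ⊕-cong (~-refl {scale a (q ⊛ r)}) (∷-cong refl (⊛-assoc p q r)) ⟩
      scale a (q ⊛ r) ⊕ (0# ∷ (p ⊛ (q ⊛ r))) ∎
    where open SR ~-setoid

  ⊛-idˡ : ∀ p → (1# ∷ []) ⊛ p ~ p
  ⊛-idˡ p = ~-trans (⊛-const 1# p) (scale-1 p)

  ⊛-idʳ : ∀ p → p ⊛ (1# ∷ []) ~ p
  ⊛-idʳ p = ~-trans (⊛-constʳ 1# p) (scale-1 p)

module PolyNormalForm (m : ℕ) (L : CommRingLaws m) where
  open PolyArithmetic m L public

  ≡⇒~ : ∀ {p q} → p ≡ q → p ~ q
  ≡⇒~ refl = ~-refl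

  stripStep : Z → Pol → Pol
  stripStep a (b ∷ r) = a ∷ b ∷ r
  stripStep a [] with a F.≟ 0#
  ... | yes _ = []
  ... | no _ = a ∷ []

  strip-step : ∀ a p → strip (a ∷ p) ≡ stripStep a (strip p)
  strip-step a p with strip p
  ... | b ∷ r = refl
  ... | [] with a F.≟ 0#
  ...   | yes _ = refl
  ...   | no _ = refl

  stripStep-~ : ∀ a S → stripStep a S ~ (a ∷ S)
  stripStep-~ a (b ∷ r) = ~-refl
  stripStep-~ a [] with a F.≟ 0#
  ... | yes e = mk~ λ { zero → sym e ; (suc n) → refl }
  ... | no _ = ~-refl

  strip-~ : ∀ p → strip p ~ p
  strip-~ [] = ~-refl
  strip-~ (a ∷ p) = ~-trans (≡⇒~ (strip-step a p)) (~-trans (stripStep-~ a (strip p)) (∷-cong refl (strip-~ p)))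

  stripStep0 : ∀ a → a ≡ 0# → stripStep a [] ≡ []
  stripStep0 a e with a F.≟ 0#
  ... | yes _ = refl
  ... | no ne = ⊥-elim (ne e)

  ~[]⇒strip : ∀ p → p ~ [] → strip p ≡ []
  ~[]⇒strip [] e = refl
  ~[]⇒strip (a ∷ p) e = trans (strip-step a p) (trans (cong (stripStep a) (~[]⇒strip p (mk~ λ n → un~ e (suc n)))) (stripStep0 a (un~ e zero)))

  ~⇒strip : ∀ p q → p ~ q → strip p ≡ strip q
  ~⇒strip [] q e = sym (~[]⇒strip q (~-sym e))
  ~⇒strip (a ∷ p) [] e = ~[]⇒strip (a ∷ p) e
  ~⇒strip (a ∷ p) (b ∷ q) e = trans (strip-step a p) (trans (cong₂ stripStep (un~ e zero) (~⇒strip p q (proj₂ (∷-inv e)))) (sym (strip-step b q)))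

  ≈⇒~ : ∀ {p q} → p ≈ q → p ~ q
  ≈⇒~ {p} {q} e = ~-trans (~-sym (strip-~ p)) (~-trans (≡⇒~ e) (strip-~ q))

  ~⇒≈ : ∀ {p q} → p ~ q → p ≈ q
  ~⇒≈ {p} {q} e = ~⇒strip p q e

  infix 4 _∣~_
  _∣~_ : Pol → Pol → Set
  d ∣~ p = Σ Pol λ q → p ~ q ⊛ d

  ∣⇒∣~ : ∀ {d p} → d ∣ p → d ∣~ p
  ∣⇒∣~ (q , e) = q , ~-sym (≈⇒~ e)

  ∣~⇒∣ : ∀ {d p} → d ∣~ p → d ∣ p
  ∣~⇒∣ (q , e) = q , ~⇒≈ (~-sym e)

  coeff-last : ∀ P c → coeff (P ++ (c ∷ [])) (length P) ≡ c
  coeff-last [] c = refl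
  coeff-last (a ∷ P) c = coeff-last P c

  last≁[] : ∀ P c → ¬ (c ≡ 0#) → ¬ ((P ++ (c ∷ [])) ~ [])
  last≁[] P c ne e = ne (trans (sym (coeff-last P c)) (un~ e (length P)))

  data Form (p : Pol) : Set where
    isZero : p ~ [] → Form p
    isLast : ∀ P c → ¬ (c ≡ 0#) → strip p ≡ P ++ (c ∷ []) → Form p

  stripStep-form : ∀ a S → (S ≡ []) ⊎ (Σ Pol λ P → Σ Z λ c → ¬ (c ≡ 0#) × (S ≡ P ++ (c ∷ []))) →
     (stripStep a S ≡ []) ⊎ (Σ Pol λ P → Σ Z λ c → ¬ (c ≡ 0#) × (stripStep a S ≡ P ++ (c ∷ [])))
  stripStep-form a .[] (inj₁ refl) with a F.≟ 0#
  ... | yes _ = inj₁ refl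
  ... | no ne = inj₂ ([] , a , ne , refl)
  stripStep-form a S (inj₂ (P , c , ne , refl)) with P
  ... | [] = inj₂ (a ∷ [] , c , ne , refl)
  ... | b ∷ P' = inj₂ (a ∷ b ∷ P' , c , ne , refl)

  strip-form' : ∀ p → (strip p ≡ []) ⊎ (Σ Pol λ P → Σ Z λ c → ¬ (c ≡ 0#) × (strip p ≡ P ++ (c ∷ [])))
  strip-form' [] = inj₁ refl
  strip-form' (a ∷ p) with stripStep-form a (strip p) (strip-form' p)
  ... | inj₁ e = inj₁ (trans (strip-step a p) e)
  ... | inj₂ (P , c , ne , e) = inj₂ (P , c , ne , trans (strip-step a p) e)

  form : ∀ p → Form p
  form p with strip-form' p
  ... | inj₁ e = isZero (~-trans (~-sym (strip-~ p)) (≡⇒~ e))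
  ... | inj₂ (P , c , ne , e) = isLast P c ne e

  strip-canon : ∀ P c → ¬ (c ≡ 0#) → strip (P ++ (c ∷ [])) ≡ P ++ (c ∷ [])
  strip-canon [] c ne with c F.≟ 0#
  ... | yes e = ⊥-elim (ne e)
  ... | no _ = refl
  strip-canon (a ∷ P) c ne = trans (strip-step a (P ++ (c ∷ []))) (trans (cong (stripStep a) (strip-canon P c ne)) (h P))
    where
    h : ∀ P → stripStep a (P ++ (c ∷ [])) ≡ a ∷ P ++ (c ∷ [])
    h [] = refl
    h (b ∷ P) = refl

  scale-snoc : ∀ a Q c → scale a (Q ++ (c ∷ [])) ≡ scale a Q ++ (a * c ∷ [])
  scale-snoc a [] c = refl
  scale-snoc a (b ∷ Q) c = cong (a * b ∷_) (scale-snoc a Q c)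

  length-scale : ∀ a Q → length (scale a Q) ≡ length Q
  length-scale a [] = refl
  length-scale a (b ∷ Q) = cong suc (length-scale a Q)

  ⊕-snoc : ∀ X Y z → length X ≤ length Y → X ⊕ (Y ++ (z ∷ [])) ≡ (X ⊕ Y) ++ (z ∷ [])
  ⊕-snoc [] Y z le = refl
  ⊕-snoc (x ∷ X) (y ∷ Y) z (s≤s le) = cong (x + y ∷_) (⊕-snoc X Y z le)

  length-⊕ : ∀ X Y → length X ≤ length Y → length (X ⊕ Y) ≡ length Y
  length-⊕ [] Y le = refl
  length-⊕ (x ∷ X) (y ∷ Y) (s≤s le) = cong suc (length-⊕ X Y le)

  ⊛-last : ∀ P a Q c → Σ Pol λ R → ((P ++ (a ∷ [])) ⊛ (Q ++ (c ∷ [])) ~ R ++ (a * c ∷ [])) × (length R ≡ length P ℕ.+ length Q)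
  ⊛-last [] a Q c = scale a Q , ~-trans (⊛-const a (Q ++ (c ∷ []))) (≡⇒~ (scale-snoc a Q c)) , length-scale a Q
  ⊛-last (e ∷ P) a Q c with ⊛-last P a Q c
  ... | R' , eq , len = scale e (Q ++ (c ∷ [])) ⊕ (0# ∷ R') ,
        ~-trans (⊕-cong (~-refl {scale e (Q ++ (c ∷ []))}) (∷-cong refl eq)) (≡⇒~ (⊕-snoc (scale e (Q ++ (c ∷ []))) (0# ∷ R') (a * c) le)) ,
        trans (length-⊕ (scale e (Q ++ (c ∷ []))) (0# ∷ R') le) (cong suc len)
    where
    le : length (scale e (Q ++ (c ∷ []))) ≤ length (0# ∷ R')
    le = subst₂ _≤_ (sym (length-scale e (Q ++ (c ∷ []))))  (cong suc (sym len))
           (subst (_≤ suc (length P ℕ.+ length Q)) (sym (trans (length-++ Q) (ℕP.+-comm (length Q) 1)))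
             (s≤s (ℕP.m≤n+m (length Q) (length P))))

  monic-cancel : ∀ f X → Monic f → f ⊛ X ~ [] → X ~ []
  monic-cancel f X (r , ef) e with form X
  ... | isZero z = z
  ... | isLast P c ne eX with ⊛-last r 1# P c
  ...   | R , eR , _ = ⊥-elim (last≁[] R (1# * c) (λ z → ne (trans (sym (*-idˡ c)) z))
            (~-trans (~-sym eR) (~-trans (≡⇒~ (sym (cong₂ _⊛_ ef eX))) (~-trans (⊛-cong (strip-~ f) (strip-~ X)) e))))

  neg : Pol → Pol
  neg p = scale (- 1#) p

  ⊕-neg : ∀ p → p ⊕ neg p ~ []
  ⊕-neg p = mk~ λ n → trans (coeff-⊕ p (neg p) n) (trans (cong (coeff p n +_) (coeff-scale (- 1#) p n)) (neg-inv (coeff p n)))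

  ⊕-neg⇒ : ∀ p q → p ⊕ neg q ~ [] → p ~ q
  ⊕-neg⇒ p q e = begin
      p ≈⟨ ~-sym (⊕-idʳ p) ⟩
      p ⊕ [] ≈⟨ ⊕-cong (~-refl {p}) (~-sym (~-trans (⊕-comm (neg q) q) (⊕-neg q))) ⟩
      p ⊕ (neg q ⊕ q) ≈⟨ ~-sym (⊕-assoc p (neg q) q) ⟩
      (p ⊕ neg q) ⊕ q ≈⟨ ⊕-cong e (~-refl {q}) ⟩
      [] ⊕ q ≈⟨ ⊕-idˡ q ⟩
      q ∎
    where open SR ~-setoid

  ~⇒⊕-neg : ∀ p q → p ~ q → p ⊕ neg q ~ []
  ~⇒⊕-neg p q e = ~-trans (⊕-cong e (~-refl {neg q})) (⊕-neg q)

  coeff0-⊛ : ∀ p q → coeff (p ⊛ q) 0 ≡ coeff p 0 * coeff q 0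
  coeff0-⊛ [] q = sym (*-zeroˡ (coeff q 0))
  coeff0-⊛ (a ∷ p) q = trans (coeff-⊕ (scale a q) (0# ∷ (p ⊛ q)) 0) (trans (+-idʳ (coeff (scale a q) 0)) (coeff-scale a q 0))

  neg-cong : ∀ {p q} → p ~ q → neg p ~ neg q
  neg-cong e = scale-cong refl e

  ∣~-trans : ∀ {a b c} → a ∣~ b → b ∣~ c → a ∣~ c
  ∣~-trans {a} {b} {c} (q1 , a∷p⊛q≈aq) (q2 , e2) = q2 ⊛ q1 , ~-trans e2 (~-trans (⊛-congʳ q2 a∷p⊛q≈aq) (~-sym (⊛-assoc q2 q1 a)))

  ∣~-mul : ∀ {d p} s → d ∣~ p → d ∣~ s ⊛ p
  ∣~-mul {d} {p} s (q , e) = s ⊛ q , ~-trans (⊛-congʳ s e) (~-sym (⊛-assoc s q d))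

  ∣~-cong : ∀ {d p p'} → p ~ p' → d ∣~ p → d ∣~ p'
  ∣~-cong e (q , e') = q , ~-trans (~-sym e) e'

module PolyRing (m : ℕ) (L : CommRingLaws m) where
  open PolyNormalForm m L public

  polynomialRing : CommutativeRing _ _
  polynomialRing = record
    { Carrier = Pol ; _≈_ = _~_ ; _+_ = _⊕_ ; _*_ = _⊛_ ; -_ = neg ; 0# = [] ; 1# = 1# ∷ []
    ; isCommutativeRing = record
      { isRing = record
        { +-isAbelianGroup = record
          { isGroup = record
            { isMonoid = record
              { isSemigroup = record
                { isMagma = record
                  { isEquivalence = record { refl = λ {p} → ~-refl {p} ; sym = λ {p} {q} → ~-sym {p} {q} ; trans = λ {p} {q} {r} → ~-trans {p} {q} {r} }
                  ; ∙-cong = ⊕-cong }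
                ; assoc = ⊕-assoc }
              ; identity = ⊕-idˡ , ⊕-idʳ }
            ; inverse = (λ p → ~-trans (⊕-comm (neg p) p) (⊕-neg p)) , ⊕-neg
            ; ⁻¹-cong = neg-cong }
          ; comm = ⊕-comm }
        ; *-cong = ⊛-cong
        ; *-assoc = ⊛-assoc
        ; *-identity = ⊛-idˡ , ⊛-idʳ
        ; distrib = ⊛-distribˡ , (λ x y z → ⊛-distribʳ y z x) }
      ; *-comm = ⊛-comm } }

  -- Solver instance for arbitrary coefficient rings: without a zero test it
  -- only proves identities in which no coefficients cancel.
  polySolverRing : ACR.AlmostCommutativeRing _ _
  polySolverRing = ACR.fromCommutativeRing polynomialRing (λ _ → Data.Maybe.nothing)

  -- A zero test by normalisation; it computes for concrete coefficient rings
  -- and lets the solver prove identities with cancellation.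
  isZero? : ∀ x → Data.Maybe.Maybe ([] ~ x)
  isZero? x with strip x in eq
  ... | [] = Data.Maybe.just (~-sym (~-trans (~-sym (strip-~ x)) (≡⇒~ eq)))
  ... | _ ∷ _ = Data.Maybe.nothing

  polySolverRing₀ : ACR.AlmostCommutativeRing _ _
  polySolverRing₀ = ACR.fromCommutativeRing polynomialRing isZero?

module CyclicReduction (m : ℕ) (L : CommRingLaws m) where
  open PolyRing m L public
  open NR polySolverRing using (solve; _⊜_)

  +-interchange : ∀ a b c d → (a + b) + (c + d) ≡ (a + c) + (b + d)
  +-interchange a b c d = trans (+-assoc a b (c + d)) (trans (cong (a +_) (trans (sym (+-assoc b c d)) (trans (cong (_+ d) (+-comm b c)) (+-assoc c b d)))) (sym (+-assoc a c (b + d))))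

  tail~ : ∀ {a p q} → (a ∷ p) ~ q → p ~ Data.List.drop 1 q
  tail~ {q = []} e = mk~ λ n → un~ e (suc n)
  tail~ {q = b ∷ q} e = mk~ λ n → un~ e (suc n)

  vec-zero : ∀ n p → p ~ [] → ∀ i → vec n p i ≡ 0#
  vec-zero n [] e i = refl
  vec-zero n (a ∷ p) e zero = trans (cong₂ _+_ (un~ e zero) (vec-zero n p (tail~ e) (prev zero))) (+-idˡ 0#)
  vec-zero n (a ∷ p) e (suc j) = vec-zero n p (tail~ e) (prev (suc j))

  vec-cong : ∀ n p q → p ~ q → ∀ i → vec n p i ≡ vec n q i
  vec-cong n [] q e i = sym (vec-zero n q (~-sym e) i)
  vec-cong n (a ∷ p) [] e i = vec-zero n (a ∷ p) e i
  vec-cong n (a ∷ p) (b ∷ q) e zero = cong₂ _+_ (un~ e zero) (vec-cong n p q (tail~ e) (prev zero))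
  vec-cong n (a ∷ p) (b ∷ q) e (suc j) = vec-cong n p q (tail~ e) (prev (suc j))

  vec-⊕ : ∀ n p q i → vec n (p ⊕ q) i ≡ vec n p i + vec n q i
  vec-⊕ n [] q i = sym (+-idˡ (vec n q i))
  vec-⊕ n (a ∷ p) [] i = sym (+-idʳ (vec n (a ∷ p) i))
  vec-⊕ n (a ∷ p) (b ∷ q) zero = trans (cong ((a + b) +_) (vec-⊕ n p q (prev zero))) (+-interchange a b (vec n p (prev zero)) (vec n q (prev zero)))
  vec-⊕ n (a ∷ p) (b ∷ q) (suc j) = vec-⊕ n p q (prev (suc j))

  vec-scale : ∀ n a p i → vec n (scale a p) i ≡ a * vec n p i
  vec-scale n a [] i = sym (*-zeroʳ a)
  vec-scale n a (b ∷ p) zero = trans (cong ((a * b) +_) (vec-scale n a p (prev zero))) (sym (distribˡ a b (vec n p (prev zero))))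
  vec-scale n a (b ∷ p) (suc j) = vec-scale n a p (prev (suc j))

  vec-x : ∀ n p i → vec n (0# ∷ p) i ≡ vec n p (prev i)
  vec-x n p zero = +-idˡ (vec n p (prev zero))
  vec-x n p (suc j) = refl

  fromVec : ∀ n → (Fin n → Z) → Pol
  fromVec zero v = []
  fromVec (suc n) v = v zero ∷ fromVec n (λ i → v (suc i))

  fromVec-cong : ∀ n (v w : Fin n → Z) → (∀ i → v i ≡ w i) → fromVec n v ≡ fromVec n w
  fromVec-cong zero v w e = refl
  fromVec-cong (suc n) v w e = cong₂ _∷_ (e zero) (fromVec-cong n (λ i → v (suc i)) (λ i → w (suc i)) (λ i → e (suc i)))

  fromVec-zero : ∀ n → fromVec n (λ _ → 0#) ~ []
  fromVec-zero zero = ~-refl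
  fromVec-zero (suc n) = mk~ λ { zero → refl ; (suc j) → un~ (fromVec-zero n) j }

  fromVec-snoc : ∀ k v → fromVec (suc k) v ≡ fromVec k (λ i → v (inject₁ i)) ++ (v (fromℕ k) ∷ [])
  fromVec-snoc zero v = refl
  fromVec-snoc (suc k) v = cong (v zero ∷_) (fromVec-snoc k (λ i → v (suc i)))

  length-fromVec : ∀ k v → length (fromVec k v) ≡ k
  length-fromVec zero v = refl
  length-fromVec (suc k) v = cong suc (length-fromVec k (λ i → v (suc i)))

  snoc-⊕ : ∀ Lst c → Lst ++ (c ∷ []) ~ Lst ⊕ (replicate (length Lst) 0# ++ (c ∷ []))
  snoc-⊕ [] c = ~-refl
  snoc-⊕ (a ∷ Lst) c = ∷-cong (sym (+-idʳ a)) (snoc-⊕ Lst c)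

  scale-rep : ∀ c k → scale c (replicate k 0# ++ (1# ∷ [])) ~ replicate k 0# ++ (c ∷ [])
  scale-rep c zero = ∷-cong (*-idʳ c) ~-refl
  scale-rep c (suc k) = ∷-cong (*-zeroʳ c) (scale-rep c k)

  Φ : ℕ → Pol
  Φ n = xⁿ-1 n

  shift-fromVec : ∀ k v → (0# ∷ fromVec (suc k) v) ~ fromVec (suc k) (λ i → v (prev i)) ⊕ scale (v (fromℕ k)) (Φ (suc k))
  shift-fromVec k v = ∷-cong head≡ tail≈
    where
    c : Z
    c = v (fromℕ k)
    w : Fin k → Z
    w = λ i → v (inject₁ i)
    head≡ : 0# ≡ c + c * ((- 1#) + 0#)
    head≡ = sym (trans (cong (λ z → c + c * z) (+-idʳ (- 1#))) (trans (cong (c +_) (*-comm c (- 1#))) (neg-inv c)))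
    tail≈ : fromVec (suc k) v ~ fromVec k w ⊕ scale c (replicate k 0# ++ (1# ∷ []))
    tail≈ = ~-trans (≡⇒~ (fromVec-snoc k v)) (~-trans (snoc-⊕ (fromVec k w) c)
           (⊕-cong (~-refl {fromVec k w}) (~-trans (≡⇒~ (cong (λ z → replicate z 0# ++ (c ∷ [])) (length-fromVec k w))) (~-sym (scale-rep c k)))))

  fromVec-addAt0 : ∀ k a (w : Fin (suc k) → Z) → fromVec (suc k) (addAt0 a w) ~ (a ∷ []) ⊕ fromVec (suc k) w
  fromVec-addAt0 k a w = ~-refl

  divide-by-Φ : ∀ k p → Σ Pol λ Q → p ~ (Φ (suc k) ⊛ Q) ⊕ fromVec (suc k) (vec (suc k) p)
  divide-by-Φ k [] = [] , ~-sym (~-trans (⊕-cong (⊛-zeroʳ (Φ (suc k))) (fromVec-zero (suc k))) (⊕-idˡ []))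
  divide-by-Φ k (a ∷ p) with divide-by-Φ k p
  ... | Q , e = (0# ∷ Q) ⊕ (c ∷ []) , goal
    where
    n : ℕ
    n = suc k
    v : Fin n → Z
    v = vec n p
    c : Z
    c = v (fromℕ k)
    P : Pol
    P = Φ n
    open SR ~-setoid
    goal : (a ∷ p) ~ (P ⊛ ((0# ∷ Q) ⊕ (c ∷ []))) ⊕ fromVec n (vec n (a ∷ p))
    goal = begin
      (a ∷ p) ≈⟨ x⊕ a p ⟩
      (a ∷ []) ⊕ (0# ∷ p) ≈⟨ ⊕-cong (~-refl {a ∷ []}) (∷-cong (sym (+-idˡ 0#)) e) ⟩
      (a ∷ []) ⊕ ((0# ∷ (P ⊛ Q)) ⊕ (0# ∷ fromVec n v)) ≈⟨ ⊕-cong (~-refl {a ∷ []}) (⊕-cong (~-sym (x-⊛ʳ P Q)) (shift-fromVec k v)) ⟩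
      (a ∷ []) ⊕ ((P ⊛ (0# ∷ Q)) ⊕ (fromVec n (λ i → v (prev i)) ⊕ scale c P)) ≈⟨ ⊕-cong (~-refl {a ∷ []}) (⊕-cong (~-refl {P ⊛ (0# ∷ Q)}) (⊕-cong (~-refl {fromVec n (λ i → v (prev i))}) (~-sym (⊛-constʳ c P)))) ⟩
      (a ∷ []) ⊕ ((P ⊛ (0# ∷ Q)) ⊕ (fromVec n (λ i → v (prev i)) ⊕ (P ⊛ (c ∷ [])))) ≈⟨ solve 5 (λ A X F Pp C → (A :+ (Pp :* X :+ (F :+ Pp :* C))) ⊜ (Pp :* (X :+ C) :+ (A :+ F))) ~-refl (a ∷ []) (0# ∷ Q) (fromVec n (λ i → v (prev i))) P (c ∷ []) ⟩
      (P ⊛ ((0# ∷ Q) ⊕ (c ∷ []))) ⊕ ((a ∷ []) ⊕ fromVec n (λ i → v (prev i))) ≈⟨ ⊕-cong (~-refl {P ⊛ ((0# ∷ Q) ⊕ (c ∷ []))}) (~-sym (fromVec-addAt0 k a (λ i → v (prev i)))) ⟩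
      (P ⊛ ((0# ∷ Q) ⊕ (c ∷ []))) ⊕ fromVec n (vec n (a ∷ p)) ∎

  vec0⇒∣ : ∀ k p → (∀ i → vec (suc k) p i ≡ 0#) → Φ (suc k) ∣~ p
  vec0⇒∣ k p z with divide-by-Φ k p
  ... | Q , e = Q , ~-trans e (~-trans (⊕-cong (⊛-comm (Φ (suc k)) Q) (~-trans (≡⇒~ (fromVec-cong (suc k) _ _ z)) (fromVec-zero (suc k)))) (⊕-idʳ (Q ⊛ Φ (suc k))))

  vec≡⇒congruent : ∀ k p q → (∀ i → vec (suc k) p i ≡ vec (suc k) q i) → Σ Pol λ Q → p ~ (Φ (suc k) ⊛ Q) ⊕ q
  vec≡⇒congruent k p q z with divide-by-Φ k p | divide-by-Φ k q
  ... | Q1 , a∷p⊛q≈aq | Q2 , e2 = Q1 ⊕ neg Q2 , goal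
    where
    P : Pol
    P = Φ (suc k)
    F : Pol
    F = fromVec (suc k) (vec (suc k) p)
    open SR ~-setoid
    goal : p ~ (P ⊛ (Q1 ⊕ neg Q2)) ⊕ q
    goal = begin
      p ≈⟨ a∷p⊛q≈aq ⟩
      (P ⊛ Q1) ⊕ F ≈⟨ ⊕-cong (~-sym (~-trans (⊕-cong (~-refl {P ⊛ Q1}) (~-trans (⊛-congʳ P (~-trans (⊕-comm (neg Q2) Q2) (⊕-neg Q2))) (⊛-zeroʳ P))) (⊕-idʳ (P ⊛ Q1)))) (~-refl {F}) ⟩
      ((P ⊛ Q1) ⊕ (P ⊛ (neg Q2 ⊕ Q2))) ⊕ F ≈⟨ solve 5 (λ Pp A N B Ff → ((Pp :* A :+ Pp :* (N :+ B)) :+ Ff) ⊜ (Pp :* (A :+ N) :+ (Pp :* B :+ Ff))) ~-refl P Q1 (neg Q2) Q2 F ⟩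
      (P ⊛ (Q1 ⊕ neg Q2)) ⊕ ((P ⊛ Q2) ⊕ F) ≈⟨ ⊕-cong (~-refl {P ⊛ (Q1 ⊕ neg Q2)}) (⊕-cong (~-refl {P ⊛ Q2}) (≡⇒~ (fromVec-cong (suc k) _ _ z))) ⟩
      (P ⊛ (Q1 ⊕ neg Q2)) ⊕ ((P ⊛ Q2) ⊕ fromVec (suc k) (vec (suc k) q)) ≈⟨ ⊕-cong (~-refl {P ⊛ (Q1 ⊕ neg Q2)}) (~-sym e2) ⟩
      (P ⊛ (Q1 ⊕ neg Q2)) ⊕ q ∎

module CyclicPairing (m : ℕ) (L : CommRingLaws m) where
  open CyclicReduction m L public

  sumV-cong : ∀ n (f g : Fin n → Z) → (∀ i → f i ≡ g i) → sumV n f ≡ sumV n g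
  sumV-cong zero f g e = refl
  sumV-cong (suc n) f g e = cong₂ _+_ (e zero) (sumV-cong n (λ i → f (suc i)) (λ i → g (suc i)) (λ i → e (suc i)))

  sumV-+ : ∀ n (f g : Fin n → Z) → sumV n (λ i → f i + g i) ≡ sumV n f + sumV n g
  sumV-+ zero f g = sym (+-idˡ 0#)
  sumV-+ (suc n) f g = trans (cong ((f zero + g zero) +_) (sumV-+ n (λ i → f (suc i)) (λ i → g (suc i)))) (+-interchange (f zero) (g zero) _ _)

  sumV-* : ∀ n a (f : Fin n → Z) → sumV n (λ i → a * f i) ≡ a * sumV n f
  sumV-* zero a f = sym (*-zeroʳ a)
  sumV-* (suc n) a f = trans (cong ((a * f zero) +_) (sumV-* n a (λ i → f (suc i)))) (sym (distribˡ a (f zero) (sumV n (λ i → f (suc i)))))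

  sumV-0 : ∀ n (f : Fin n → Z) → (∀ i → f i ≡ 0#) → sumV n f ≡ 0#
  sumV-0 zero f e = refl
  sumV-0 (suc n) f e = trans (cong₂ _+_ (e zero) (sumV-0 n (λ i → f (suc i)) (λ i → e (suc i)))) (+-idˡ 0#)

  sumV-last : ∀ k (f : Fin (suc k) → Z) → sumV (suc k) f ≡ sumV k (λ i → f (inject₁ i)) + f (fromℕ k)
  sumV-last zero f = trans (+-idʳ (f zero)) (sym (+-idˡ (f zero)))
  sumV-last (suc k) f = trans (cong (f zero +_) (sumV-last k (λ i → f (suc i)))) (sym (+-assoc (f zero) _ _))

  sumV-rot : ∀ k (f : Fin (suc k) → Z) → sumV (suc k) (λ i → f (prev i)) ≡ sumV (suc k) f
  sumV-rot k f = trans (+-comm (f (fromℕ k)) _) (sym (sumV-last k f))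

  shift : ℕ → Pol → Pol
  shift j p = replicate j 0# ++ p

  shift-shift : ∀ a b q → shift a (shift b q) ≡ shift (a ℕ.+ b) q
  shift-shift zero b q = refl
  shift-shift (suc a) b q = cong (0# ∷_) (shift-shift a b q)

  shift-cong : ∀ j {p q} → p ~ q → shift j p ~ shift j q
  shift-cong zero e = e
  shift-cong (suc j) e = ∷-cong refl (shift-cong j e)

  shift-[] : ∀ j → shift j [] ~ []
  shift-[] zero = ~-refl
  shift-[] (suc j) = mk~ λ { zero → refl ; (suc t) → un~ (shift-[] j) t }

  shift-⊕ : ∀ j p q → shift j (p ⊕ q) ~ shift j p ⊕ shift j q
  shift-⊕ zero p q = ~-refl
  shift-⊕ (suc j) p q = ∷-cong (sym (+-idˡ 0#)) (shift-⊕ j p q)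

  shift-scale : ∀ j a p → shift j (scale a p) ~ scale a (shift j p)
  shift-scale zero a p = ~-refl
  shift-scale (suc j) a p = ∷-cong (sym (*-zeroʳ a)) (shift-scale j a p)

  shift-⊛ˡ : ∀ j p q → shift j p ⊛ q ~ shift j (p ⊛ q)
  shift-⊛ˡ zero p q = ~-refl
  shift-⊛ˡ (suc j) p q = ~-trans (x-⊛ˡ (shift j p) q) (∷-cong refl (shift-⊛ˡ j p q))

  shift-⊛ʳ : ∀ j p q → p ⊛ shift j q ~ shift j (p ⊛ q)
  shift-⊛ʳ zero p q = ~-refl
  shift-⊛ʳ (suc j) p q = ~-trans (x-⊛ʳ p (shift j q)) (∷-cong refl (shift-⊛ʳ j p q))

  shift-x : ∀ j X → shift j (0# ∷ X) ≡ shift (suc j) X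
  shift-x j X = trans (shift-shift j 1 X) (cong (λ z → shift z X) (ℕP.+-comm j 1))

  shift-cons : ∀ j a p → shift j (a ∷ p) ~ shift j (a ∷ []) ⊕ shift (suc j) p
  shift-cons j a p = ~-trans (shift-cong j (x⊕ a p)) (~-trans (shift-⊕ j (a ∷ []) (0# ∷ p))
     (⊕-cong (~-refl {shift j (a ∷ [])}) (≡⇒~ (trans (shift-shift j 1 p) (cong (λ z → shift z p) (ℕP.+-comm j 1))))))

  shift-mono : ∀ j X → shift j (1# ∷ []) ⊛ X ~ shift j X
  shift-mono j X = ~-trans (shift-⊛ˡ j (1# ∷ []) X) (shift-cong j (⊛-idˡ X))

  ρ : Pol → Pol
  ρ p = 0# ∷ reverse p

  ρ-cons : ∀ a p → ρ (a ∷ p) ~ ρ p ⊕ shift (suc (length p)) (a ∷ [])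
  ρ-cons a p = ∷-cong (sym (+-idˡ 0#)) (~-trans (≡⇒~ (unfold-reverse a p)) (~-trans (snoc-⊕ (reverse p) a)
     (⊕-cong (~-refl {reverse p}) (≡⇒~ (cong (λ z → replicate z 0# ++ (a ∷ [])) (length-reverse p))))))

  rep-snoc : ∀ z (x : Z) → replicate z x ++ (x ∷ []) ≡ x ∷ replicate z x
  rep-snoc zero x = refl
  rep-snoc (suc z) x = cong (x ∷_) (rep-snoc z x)

  reverse-rep : ∀ z (x : Z) → reverse (replicate z x) ≡ replicate z x
  reverse-rep zero x = refl
  reverse-rep (suc z) x = trans (unfold-reverse x (replicate z x)) (trans (cong (_++ (x ∷ [])) (reverse-rep z x)) (rep-snoc z x))

  strip-pad : ∀ p → Σ ℕ λ z → p ≡ strip p ++ replicate z 0#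
  strip-pad [] = 0 , refl
  strip-pad (a ∷ p) with strip-pad p
  ... | z , e with h (strip p) e
    where
    h : ∀ S → p ≡ S ++ replicate z 0# → Σ ℕ λ z' → (a ∷ p) ≡ stripStep a S ++ replicate z' 0#
    h (b ∷ r) e = z , cong (a ∷_) e
    h [] e with a F.≟ 0#
    ... | yes a0 = suc z , cong₂ _∷_ a0 e
    ... | no _ = z , cong (a ∷_) e
  ... | z' , e' = z' , trans e' (cong (_++ replicate z' 0#) (sym (strip-step a p)))

  ρ-rec : ∀ p → Σ ℕ λ z → ρ p ≡ shift (suc z) (p *)
  ρ-rec p with strip-pad p
  ... | z , e = z , cong (0# ∷_) (trans (cong reverse e) (trans (reverse-++ (strip p) (replicate z 0#)) (cong (_++ reverse (strip p)) (reverse-rep z 0#))))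

  module Cyclic (k : ℕ) where
    n : ℕ
    n = suc k

    at : Pol → ℕ → Z
    at q t = vec n q (t mod n)

    toℕ-mod : ∀ t → toℕ (t mod n) ≡ t % n
    toℕ-mod t = toℕ-fromℕ< (m%n<n t n)

    mod-cong : ∀ s t → s % n ≡ t % n → s mod n ≡ t mod n
    mod-cong s t e = toℕ-injective (trans (toℕ-mod s) (trans e (sym (toℕ-mod t))))

    toℕ-prev : ∀ (i : Fin n) → toℕ (prev i) ≡ (toℕ i ℕ.+ k) % n
    toℕ-prev zero = trans (toℕ-fromℕ k) (sym (m≤n⇒m%n≡m (ℕP.≤-refl {k})))
    toℕ-prev (suc j) = trans (toℕ-inject₁ j) (sym (trans (cong (_% n) (sym (ℕP.+-suc (toℕ j) k))) (trans ([m+n]%n≡m%n (toℕ j) n) (m<n⇒m%n≡m (ℕP.<-trans (toℕ<n j) (ℕP.n<1+n k))))))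

    prev-mod : ∀ t → prev (suc t mod n) ≡ t mod n
    prev-mod t = toℕ-injective (trans (toℕ-prev (suc t mod n)) (trans (cong (λ z → (z ℕ.+ k) % n) (toℕ-mod (suc t))) (trans e (sym (toℕ-mod t)))))
      where
      e : (suc t % n ℕ.+ k) % n ≡ t % n
      e = begin
        (suc t % n ℕ.+ k) % n ≡⟨ %-distribˡ-+ (suc t % n) k n ⟩
        (suc t % n % n ℕ.+ k % n) % n ≡⟨ cong (λ z → (z ℕ.+ k % n) % n) (m%n%n≡m%n (suc t) n) ⟩
        (suc t % n ℕ.+ k % n) % n ≡⟨ sym (%-distribˡ-+ (suc t) k n) ⟩
        (suc t ℕ.+ k) % n ≡⟨ cong (_% n) (sym (ℕP.+-suc t k)) ⟩
        (t ℕ.+ n) % n ≡⟨ [m+n]%n≡m%n t n ⟩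
        t % n ∎
        where open ≡-Reasoning

    at-x : ∀ q t → at (0# ∷ q) (suc t) ≡ at q t
    at-x q t = trans (vec-x n q (suc t mod n)) (cong (vec n q) (prev-mod t))

    at-period : ∀ q t → at q (t ℕ.+ n) ≡ at q t
    at-period q t = cong (vec n q) (mod-cong (t ℕ.+ n) t ([m+n]%n≡m%n t n))

    at-period* : ∀ q t j → at q (t ℕ.+ j ℕ.* n) ≡ at q t
    at-period* q t zero = cong (at q) (ℕP.+-identityʳ t)
    at-period* q t (suc j) = trans (cong (at q) (trans (cong (t ℕ.+_) (ℕP.+-comm n (j ℕ.* n))) (sym (ℕP.+-assoc t (j ℕ.* n) n)))) (trans (at-period q (t ℕ.+ j ℕ.* n)) (at-period* q t j))

    vec-at : ∀ q (i : Fin n) → vec n q i ≡ at q (toℕ i)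
    vec-at q i = cong (vec n q) (sym (toℕ-injective (trans (toℕ-mod (toℕ i)) (m<n⇒m%n≡m (toℕ<n i)))))

    at-cong : ∀ p q t → p ~ q → at p t ≡ at q t
    at-cong p q t e = vec-cong n p q e (t mod n)

    at-⊕ : ∀ p q t → at (p ⊕ q) t ≡ at p t + at q t
    at-⊕ p q t = vec-⊕ n p q (t mod n)

    at-scale : ∀ a p t → at (scale a p) t ≡ a * at p t
    at-scale a p t = vec-scale n a p (t mod n)

    at-zero : ∀ p t → p ~ [] → at p t ≡ 0#
    at-zero p t e = vec-zero n p e (t mod n)

    at-shift : ∀ q t j → at (shift j q) (t ℕ.+ j) ≡ at q t
    at-shift q t zero = cong (at q) (ℕP.+-identityʳ t)
    at-shift q t (suc j) = trans (cong (at (shift (suc j) q)) (ℕP.+-suc t j)) (trans (at-x (shift j q) (t ℕ.+ j)) (at-shift q t j))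

    vec-shiftn : ∀ q i → vec n (shift n q) i ≡ vec n q i
    vec-shiftn q i = trans (vec-at (shift n q) i) (trans (sym (at-period (shift n q) (toℕ i))) (trans (at-shift q (toℕ i) n) (sym (vec-at q i))))

    vec-shift* : ∀ j q i → vec n (shift (j ℕ.* n) q) i ≡ vec n q i
    vec-shift* zero q i = refl
    vec-shift* (suc j) q i = trans (cong (λ z → vec n z i) (sym (shift-shift n (j ℕ.* n) q))) (trans (vec-shiftn (shift (j ℕ.* n) q) i) (vec-shift* j q i))

    Φ⊛ : ∀ w → Φ n ⊛ w ~ shift n w ⊕ neg w
    Φ⊛ w = ~-trans (⊛-distribʳ ((- 1#) ∷ []) (shift n (1# ∷ [])) w)
             (~-trans (⊕-cong (⊛-const (- 1#) w) (~-trans (shift-⊛ˡ n (1# ∷ []) w) (shift-cong n (⊛-idˡ w)))) (⊕-comm (neg w) (shift n w)))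

    vec-Φ : ∀ w i → vec n (Φ n ⊛ w) i ≡ 0#
    vec-Φ w i = trans (vec-cong n _ _ (Φ⊛ w) i) (trans (vec-⊕ n (shift n w) (neg w) i)
      (trans (cong₂ _+_ (vec-shiftn w i) (vec-scale n (- 1#) w i)) (neg-inv (vec n w i))))

    ∣⇒vec0 : ∀ p → Φ n ∣~ p → ∀ i → vec n p i ≡ 0#
    ∣⇒vec0 p (Q , e) i = trans (vec-cong n _ _ (~-trans e (⊛-comm Q (Φ n))) i) (vec-Φ Q i)

    pair : Pol → Pol → Z
    pair p v = sumV n (λ i → vec n p i * vec n v i)

    pair-vecˡ : ∀ p p' v → (∀ i → vec n p i ≡ vec n p' i) → pair p v ≡ pair p' v
    pair-vecˡ p p' v e = sumV-cong n _ _ (λ i → cong (λ z → z * vec n v i) (e i))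

    pair-vecʳ : ∀ p v v' → (∀ i → vec n v i ≡ vec n v' i) → pair p v ≡ pair p v'
    pair-vecʳ p v v' e = sumV-cong n _ _ (λ i → cong (vec n p i *_) (e i))

    pair-congˡ : ∀ p p' v → p ~ p' → pair p v ≡ pair p' v
    pair-congˡ p p' v e = pair-vecˡ p p' v (vec-cong n p p' e)

    pair-⊕ˡ : ∀ p q v → pair (p ⊕ q) v ≡ pair p v + pair q v
    pair-⊕ˡ p q v = trans (sumV-cong n _ _ (λ i → trans (cong (λ z → z * vec n v i) (vec-⊕ n p q i)) (distribʳ (vec n v i) (vec n p i) (vec n q i))))
                          (sumV-+ n (λ i → vec n p i * vec n v i) (λ i → vec n q i * vec n v i))

    pair-scaleˡ : ∀ a p v → pair (scale a p) v ≡ a * pair p v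
    pair-scaleˡ a p v = trans (sumV-cong n _ _ (λ i → trans (cong (λ z → z * vec n v i) (vec-scale n a p i)) (*-assoc a (vec n p i) (vec n v i))))
                          (sumV-* n a (λ i → vec n p i * vec n v i))

    pair-zeroˡ : ∀ p v → p ~ [] → pair p v ≡ 0#
    pair-zeroˡ p v e = sumV-0 n _ (λ i → trans (cong (λ z → z * vec n v i) (vec-zero n p e i)) (*-zeroˡ (vec n v i)))

    pair-sym : ∀ p v → pair p v ≡ pair v p
    pair-sym p v = sumV-cong n _ _ (λ i → *-comm (vec n p i) (vec n v i))

    pair-x : ∀ p v → pair (0# ∷ p) (0# ∷ v) ≡ pair p v
    pair-x p v = trans (sumV-cong n _ _ (λ i → cong₂ _*_ (vec-x n p i) (vec-x n v i))) (sumV-rot k (λ i → vec n p i * vec n v i))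

    pair-shift : ∀ j p v → pair (shift j p) (shift j v) ≡ pair p v
    pair-shift zero p v = refl
    pair-shift (suc j) p v = trans (pair-x (shift j p) (shift j v)) (pair-shift j p v)

    pair-const : ∀ a v → pair (a ∷ []) v ≡ a * at v 0
    pair-const a v = trans (cong₂ _+_ (cong (λ z → z * vec n v zero) (+-idʳ a)) (sumV-0 k _ (λ i → *-zeroˡ (vec n v (suc i))))) (trans (+-idʳ (a * vec n v zero)) (cong (a *_) (vec-at v zero)))

    pair-mono : ∀ j a v → pair (shift j (a ∷ [])) v ≡ a * at v j
    pair-mono zero a v = pair-const a v
    pair-mono (suc j) a v = begin
        pair (0# ∷ shift j (a ∷ [])) v ≡⟨ pair-vecʳ (0# ∷ shift j (a ∷ [])) v (shift n v) (λ i → sym (vec-shiftn v i)) ⟩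
        pair (0# ∷ shift j (a ∷ [])) (0# ∷ shift k v) ≡⟨ pair-x (shift j (a ∷ [])) (shift k v) ⟩
        pair (shift j (a ∷ [])) (shift k v) ≡⟨ pair-mono j a (shift k v) ⟩
        a * at (shift k v) j ≡⟨ cong (a *_) (sym (at-period (shift k v) j)) ⟩
        a * at (shift k v) (j ℕ.+ n) ≡⟨ cong (λ z → a * at (shift k v) z) (ℕP.+-suc j k) ⟩
        a * at (shift k v) (suc j ℕ.+ k) ≡⟨ cong (a *_) (at-shift v (suc j) k) ⟩
        a * at v (suc j) ∎
      where open ≡-Reasoning

    pair-shift≡at : ∀ p j v → pair (shift j p) v ≡ at (v ⊛ ρ p) (j ℕ.+ length p)
    pair-shift≡at [] j v = trans (pair-zeroˡ (shift j []) v (shift-[] j)) (sym (at-zero (v ⊛ ρ []) (j ℕ.+ 0) (~-trans (⊛-constʳ 0# v) (scale-0 v))))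
    pair-shift≡at (a ∷ p) j v = begin
        pair (shift j (a ∷ p)) v ≡⟨ pair-congˡ _ _ v (shift-cons j a p) ⟩
        pair (shift j (a ∷ []) ⊕ shift (suc j) p) v ≡⟨ pair-⊕ˡ (shift j (a ∷ [])) (shift (suc j) p) v ⟩
        pair (shift j (a ∷ [])) v + pair (shift (suc j) p) v ≡⟨ cong₂ _+_ (pair-mono j a v) (pair-shift≡at p (suc j) v) ⟩
        a * at v j + at (v ⊛ ρ p) (suc j ℕ.+ length p) ≡⟨ +-comm (a * at v j) _ ⟩
        at (v ⊛ ρ p) (suc j ℕ.+ length p) + a * at v j ≡⟨ cong₂ _+_ (cong (at (v ⊛ ρ p)) (sym (ℕP.+-suc j (length p)))) (sym (trans (at-shift (scale a v) j (suc (length p))) (at-scale a v j))) ⟩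
        at (v ⊛ ρ p) (j ℕ.+ suc (length p)) + at (shift (suc (length p)) (scale a v)) (j ℕ.+ suc (length p)) ≡⟨ sym (at-⊕ (v ⊛ ρ p) (shift (suc (length p)) (scale a v)) (j ℕ.+ suc (length p))) ⟩
        at ((v ⊛ ρ p) ⊕ shift (suc (length p)) (scale a v)) (j ℕ.+ suc (length p)) ≡⟨ at-cong _ _ (j ℕ.+ suc (length p)) e ⟩
        at (v ⊛ ρ (a ∷ p)) (j ℕ.+ length (a ∷ p)) ∎
      where
      open ≡-Reasoning
      e : (v ⊛ ρ p) ⊕ shift (suc (length p)) (scale a v) ~ v ⊛ ρ (a ∷ p)
      e = ~-sym (~-trans (⊛-congʳ v (ρ-cons a p)) (~-trans (⊛-distribˡ v (ρ p) _)
            (⊕-cong (~-refl {v ⊛ ρ p}) (~-trans (shift-⊛ʳ (suc (length p)) v (a ∷ [])) (shift-cong (suc (length p)) (⊛-constʳ a v))))))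

    Orthogonal : Pol → Pol → Set
    Orthogonal p v = ∀ j → pair (shift j p) v ≡ 0#

    divisible⇒orthogonal : ∀ p v → Φ n ∣~ (v ⊛ ρ p) → Orthogonal p v
    divisible⇒orthogonal p v d j = trans (pair-shift≡at p j v) (∣⇒vec0 (v ⊛ ρ p) d ((j ℕ.+ length p) mod n))

    orthogonal⇒divisible : ∀ p v → Orthogonal p v → Φ n ∣~ (v ⊛ ρ p)
    orthogonal⇒divisible p v o = vec0⇒∣ k (v ⊛ ρ p) λ i → begin
        vec n (v ⊛ ρ p) i ≡⟨ vec-at (v ⊛ ρ p) i ⟩
        at (v ⊛ ρ p) (toℕ i) ≡⟨ sym (at-period* (v ⊛ ρ p) (toℕ i) (length p)) ⟩
        at (v ⊛ ρ p) (toℕ i ℕ.+ length p ℕ.* n) ≡⟨ cong (at (v ⊛ ρ p)) (arith (toℕ i) (length p)) ⟩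
        at (v ⊛ ρ p) ((toℕ i ℕ.+ length p ℕ.* k) ℕ.+ length p) ≡⟨ sym (pair-shift≡at p (toℕ i ℕ.+ length p ℕ.* k) v) ⟩
        pair (shift (toℕ i ℕ.+ length p ℕ.* k) p) v ≡⟨ o (toℕ i ℕ.+ length p ℕ.* k) ⟩
        0# ∎
      where
      open ≡-Reasoning
      arith : ∀ a l → a ℕ.+ l ℕ.* n ≡ (a ℕ.+ l ℕ.* k) ℕ.+ l
      arith a l = trans (cong (a ℕ.+_) (trans (ℕP.*-suc l k) (ℕP.+-comm l (l ℕ.* k)))) (sym (ℕP.+-assoc a (l ℕ.* k) l))

    orthogonal⇒multiples : ∀ p v → Orthogonal p v → ∀ s → pair (s ⊛ p) v ≡ 0#
    orthogonal⇒multiples p v o s = go s 0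
      where
      go : ∀ s j → pair (shift j (s ⊛ p)) v ≡ 0#
      go [] j = pair-zeroˡ (shift j []) v (shift-[] j)
      go (c ∷ s) j = begin
          pair (shift j (scale c p ⊕ (0# ∷ (s ⊛ p)))) v ≡⟨ pair-congˡ _ _ v (~-trans (shift-⊕ j (scale c p) (0# ∷ (s ⊛ p))) (⊕-cong (shift-scale j c p) (≡⇒~ (shift-x j (s ⊛ p))))) ⟩
          pair (scale c (shift j p) ⊕ shift (suc j) (s ⊛ p)) v ≡⟨ pair-⊕ˡ (scale c (shift j p)) (shift (suc j) (s ⊛ p)) v ⟩
          pair (scale c (shift j p)) v + pair (shift (suc j) (s ⊛ p)) v ≡⟨ cong₂ _+_ (trans (pair-scaleˡ c (shift j p) v) (trans (cong (c *_) (o j)) (*-zeroʳ c))) (go s (suc j)) ⟩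
          0# + 0# ≡⟨ +-idˡ 0# ⟩
          0# ∎
        where open ≡-Reasoning

    -- The relation is symmetric, since ⟨x^j p, v⟩ = ⟨p, x^(−j) v⟩.
    orthogonal-sym : ∀ p v → Orthogonal p v → Orthogonal v p
    orthogonal-sym p v o j = begin
        pair (shift j v) p ≡⟨ pair-sym (shift j v) p ⟩
        pair p (shift j v) ≡⟨ sym (pair-shift (j ℕ.* k) p (shift j v)) ⟩
        pair (shift (j ℕ.* k) p) (shift (j ℕ.* k) (shift j v)) ≡⟨ cong (pair (shift (j ℕ.* k) p)) (trans (shift-shift (j ℕ.* k) j v) (cong (λ z → shift z v) (trans (ℕP.+-comm (j ℕ.* k) j) (sym (ℕP.*-suc j k))))) ⟩
        pair (shift (j ℕ.* k) p) (shift (j ℕ.* n) v) ≡⟨ pair-vecʳ (shift (j ℕ.* k) p) (shift (j ℕ.* n) v) v (vec-shift* j v) ⟩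
        pair (shift (j ℕ.* k) p) v ≡⟨ o (j ℕ.* k) ⟩
        0# ∎
      where open ≡-Reasoning

    -- x is invertible modulo x^n − 1.
    Φ∣shift⇒ : ∀ j q → Φ n ∣~ shift j q → Φ n ∣~ q
    Φ∣shift⇒ j q d = vec0⇒∣ k q λ i → begin
        vec n q i ≡⟨ sym (vec-shift* j q i) ⟩
        vec n (shift (j ℕ.* n) q) i ≡⟨ cong (λ z → vec n z i) (trans (cong (λ z → shift z q) (trans (ℕP.*-suc j k) (ℕP.+-comm j (j ℕ.* k)))) (sym (shift-shift (j ℕ.* k) j q))) ⟩
        vec n (shift (j ℕ.* k) (shift j q)) i ≡⟨ ∣⇒vec0 _ (∣~-cong (shift-mono (j ℕ.* k) (shift j q)) (∣~-mul (shift (j ℕ.* k) (1# ∷ [])) d)) i ⟩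
        0# ∎
      where open ≡-Reasoning

    multiples⇒orthogonal : ∀ p v → (∀ s → pair (s ⊛ p) v ≡ 0#) → Orthogonal p v
    multiples⇒orthogonal p v o j = trans (pair-congˡ (shift j p) (shift j (1# ∷ []) ⊛ p) v (~-sym (shift-mono j p))) (o (shift j (1# ∷ [])))

    orthogonal⇒reciprocal-divisible : ∀ p v → Orthogonal v p → Φ n ∣~ p ⊛ (v *)
    orthogonal⇒reciprocal-divisible p v o with ρ-rec v
    ... | z , eρ = Φ∣shift⇒ (suc z) (p ⊛ (v *)) (∣~-cong (~-trans (⊛-congʳ p (≡⇒~ eρ)) (shift-⊛ʳ (suc z) p (v *))) (orthogonal⇒divisible v p o))

    reciprocal-cofactor⇒orthogonal : ∀ D d → D ⊛ (d *) ~ Φ n → ∀ s → pair (s ⊛ d) D ≡ 0#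
    reciprocal-cofactor⇒orthogonal D d eD = orthogonal⇒multiples d D (divisible⇒orthogonal d D divides)
      where
      divides : Φ n ∣~ D ⊛ ρ d
      divides with ρ-rec d
      ... | z , eρ = shift (suc z) (1# ∷ []) , ~-trans (⊛-congʳ D (≡⇒~ eρ)) (~-trans (shift-⊛ʳ (suc z) D (d *))
          (~-trans (shift-cong (suc z) eD) (~-sym (shift-mono (suc z) (Φ n)))))

module Binary where

  open CyclicPairing 1 ℤ₂-laws public

  coprime-divides : ∀ u v g h Y R → u ⊛ g ⊕ v ⊛ h ~ (1# ∷ []) → g ⊛ Y ~ h ⊛ R → Σ Pol λ W → Y ~ h ⊛ W
  coprime-divides u v g h Y R bézout gY≡hR = u ⊛ R ⊕ v ⊛ Y , (begin
      Y                               ≈⟨ ~-sym (⊛-idˡ Y) ⟩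
      (1# ∷ []) ⊛ Y                   ≈⟨ ⊛-congˡ Y (~-sym bézout) ⟩
      (u ⊛ g ⊕ v ⊛ h) ⊛ Y             ≈⟨ solve 5 (λ U V G' H' Yv → ((U :* G' :+ V :* H') :* Yv) ⊜ (U :* (G' :* Yv) :+ H' :* (V :* Yv))) ~-refl u v g h Y ⟩
      u ⊛ (g ⊛ Y) ⊕ h ⊛ (v ⊛ Y)       ≈⟨ ⊕-cong (⊛-congʳ u gY≡hR) (~-refl {h ⊛ (v ⊛ Y)}) ⟩
      u ⊛ (h ⊛ R) ⊕ h ⊛ (v ⊛ Y)       ≈⟨ solve 5 (λ U H' R' V Yv → (U :* (H' :* R') :+ H' :* (V :* Yv)) ⊜ (H' :* (U :* R' :+ V :* Yv))) ~-refl u h R v Y ⟩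
      h ⊛ (u ⊛ R ⊕ v ⊛ Y)             ∎)
    where
    open SR ~-setoid
    open NR polySolverRing₀ using (solve; _⊜_)

  nonzero-bit : ∀ (c : Fin 2) → ¬ (c ≡ 0#) → c ≡ 1#
  nonzero-bit zero ne = ⊥-elim (ne refl)
  nonzero-bit (suc zero) ne = refl

  char2 : ∀ p → p ⊕ p ~ []
  char2 p = mk~ λ n → trans (coeff-⊕ p p n) (h (coeff p n))
    where
    h : ∀ (a : Fin 2) → a + a ≡ 0#
    h zero = refl
    h (suc zero) = refl

  neg≡ : ∀ p → neg p ~ p
  neg≡ p = mk~ λ n → trans (coeff-scale (- 1#) p n) (h (coeff p n))
    where
    h : ∀ (a : Fin 2) → (- 1#) * a ≡ a
    h zero = refl
    h (suc zero) = refl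

  ⊕⇒~ : ∀ p q → p ⊕ q ~ [] → p ~ q
  ⊕⇒~ p q e = ⊕-neg⇒ p q (~-trans (⊕-cong (~-refl {p}) (neg≡ q)) e)

  ~⇒⊕ : ∀ p q → p ~ q → p ⊕ q ~ []
  ~⇒⊕ p q e = ~-trans (⊕-cong e (~-refl {q})) (char2 q)

  Nonzero : Pol → Set
  Nonzero p = ¬ (p ~ [])

  nonzero-form : ∀ p → Nonzero p → Σ Pol λ P → strip p ≡ P ++ (1# ∷ [])
  nonzero-form p nz with form p
  ... | isZero z = ⊥-elim (nz z)
  ... | isLast P c ne e = P , trans e (cong (λ z → P ++ (z ∷ [])) (nonzero-bit c ne))

  canonical-nonzero : ∀ P → Nonzero (P ++ (1# ∷ []))
  canonical-nonzero P = last≁[] P 1# (λ ())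

  strip-nonzero : ∀ p P → strip p ≡ P ++ (1# ∷ []) → Nonzero p
  strip-nonzero p P e z = canonical-nonzero P (~-trans (≡⇒~ (sym e)) (~-trans (strip-~ p) z))

  ProductForm : Pol → Pol → Set
  ProductForm p q = Σ Pol λ P → Σ Pol λ Q → Σ Pol λ R →
    (strip p ≡ P ++ (1# ∷ [])) × (strip q ≡ Q ++ (1# ∷ [])) × (strip (p ⊛ q) ≡ R ++ (1# ∷ [])) × (length R ≡ length P ℕ.+ length Q)

  prod-strip : ∀ p q → Nonzero p → Nonzero q → ProductForm p q
  prod-strip p q np nq with nonzero-form p np | nonzero-form q nq
  ... | P , eP | Q , eQ with ⊛-last P 1# Q 1#
  ...   | R , eR , len = P , Q , R , eP , eQ , trans (~⇒strip (p ⊛ q) (R ++ (1# ∷ [])) e) (strip-canon R 1# (λ ())) , len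
    where
    e : p ⊛ q ~ R ++ (1# ∷ [])
    e = ~-trans (⊛-cong (~-sym (strip-~ p)) (~-sym (strip-~ q))) (~-trans (≡⇒~ (cong₂ _⊛_ eP eQ)) eR)

  domain : ∀ p q → Nonzero p → Nonzero q → Nonzero (p ⊛ q)
  domain p q np nq with prod-strip p q np nq
  ... | P , Q , R , _ , _ , eR , _ = strip-nonzero (p ⊛ q) R eR

  cancel : ∀ p q r → Nonzero p → p ⊛ q ~ p ⊛ r → q ~ r
  cancel p q r np e with form (q ⊕ r)
  ... | isZero z = ⊕⇒~ q r z
  ... | isLast P c ne eq = ⊥-elim (domain p (q ⊕ r) np (strip-nonzero (q ⊕ r) P (trans eq (cong (λ z → P ++ (z ∷ [])) (nonzero-bit c ne))))
          (~-trans (⊛-distribˡ p q r) (~⇒⊕ (p ⊛ q) (p ⊛ r) e)))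

  unit : ∀ s t → s ⊛ t ~ (1# ∷ []) → s ~ (1# ∷ [])
  unit s t e = degree-zero (prod-strip s t s≉0 t≉0)
    where
    s≉0 : Nonzero s
    s≉0 z = canonical-nonzero [] (~-trans (~-sym e) (⊛-zeroˡ s t z))
    t≉0 : Nonzero t
    t≉0 z = canonical-nonzero [] (~-trans (~-sym e) (~-trans (⊛-comm s t) (⊛-zeroˡ t s z)))
    R-empty : ∀ R → R ++ (1# ∷ []) ≡ 1# ∷ [] → R ≡ []
    R-empty [] _ = refl
    R-empty (x ∷ []) ()
    R-empty (x ∷ y ∷ R') ()
    P-empty : ∀ (P : Pol) {l} → length P ℕ.+ l ≡ 0 → P ≡ []
    P-empty [] e = refl
    P-empty (x ∷ X) ()
    -- deg s + deg t = deg 1 = 0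
    degree-zero : ProductForm s t → s ~ (1# ∷ [])
    degree-zero (P , Q , R , eS , _ , eR , len) = ≈⇒~ (trans eS (cong (_++ (1# ∷ [])) P≡[]))
      where
      R≡[] : R ≡ []
      R≡[] = R-empty R (trans (sym eR) (~⇒strip (s ⊛ t) (1# ∷ []) e))
      P≡[] : P ≡ []
      P≡[] = P-empty P (trans (sym len) (cong length R≡[]))

  -- revPad N p = reversed coefficients p_N, …, p_0 (x^N·p(1/x) when deg p ≤ N).
  revPad : ℕ → Pol → Pol
  revPad zero p = coeff p 0 ∷ []
  revPad (suc N) p = coeff p (suc N) ∷ revPad N p

  revPad-cong : ∀ N {p q} → p ~ q → revPad N p ≡ revPad N q
  revPad-cong zero e = cong (_∷ []) (un~ e 0)
  revPad-cong (suc N) e = cong₂ _∷_ (un~ e (suc N)) (revPad-cong N e)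

  revPad-cons : ∀ N a p → revPad (suc N) (a ∷ p) ≡ revPad N p ++ (a ∷ [])
  revPad-cons zero a p = refl
  revPad-cons (suc N) a p = cong (coeff p (suc N) ∷_) (revPad-cons N a p)

  length-revPad : ∀ N p → length (revPad N p) ≡ suc N
  length-revPad zero p = refl
  length-revPad (suc N) p = cong suc (length-revPad N p)

  reverse-revPad : ∀ a S → reverse (a ∷ S) ≡ revPad (length S) (a ∷ S)
  reverse-revPad a [] = refl
  reverse-revPad a (b ∷ S) = trans (unfold-reverse a (b ∷ S)) (trans (cong (_++ (a ∷ [])) (reverse-revPad b S)) (sym (revPad-cons (length S) a (b ∷ S))))

  rec-revPad : ∀ p P → strip p ≡ P ++ (1# ∷ []) → p * ≡ revPad (length P) p
  rec-revPad p P e = trans (cong reverse e) (trans (h P) (revPad-cong (length P) (~-trans (≡⇒~ (sym e)) (strip-~ p))))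
    where
    h : ∀ P → reverse (P ++ (1# ∷ [])) ≡ revPad (length P) (P ++ (1# ∷ []))
    h [] = refl
    h (a ∷ P) = trans (reverse-revPad a (P ++ (1# ∷ []))) (cong (λ z → revPad z (a ∷ P ++ (1# ∷ []))) (trans (length-++ P) (ℕP.+-comm (length P) 1)))

  Deg≤ : Pol → ℕ → Set
  Deg≤ p N = ∀ i → N < i → coeff p i ≡ 0#

  coeff-beyond : ∀ (S : Pol) i → length S ≤ i → coeff S i ≡ 0#
  coeff-beyond [] i le = refl
  coeff-beyond (a ∷ S) (suc i) (s≤s le) = coeff-beyond S i le

  strip-deg : ∀ p P → strip p ≡ P ++ (1# ∷ []) → Deg≤ p (length P)
  strip-deg p P e i lt = trans (sym (un~ (strip-~ p) i)) (trans (cong (λ z → coeff z i) e)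
     (coeff-beyond (P ++ (1# ∷ [])) i (subst (_≤ i) (sym (trans (length-++ P) (ℕP.+-comm (length P) 1))) lt)))

  revPad-⊕ : ∀ N p q → revPad N (p ⊕ q) ~ revPad N p ⊕ revPad N q
  revPad-⊕ zero p q = ∷-cong (coeff-⊕ p q 0) ~-refl
  revPad-⊕ (suc N) p q = ∷-cong (coeff-⊕ p q (suc N)) (revPad-⊕ N p q)

  revPad-scale : ∀ N a p → revPad N (scale a p) ~ scale a (revPad N p)
  revPad-scale zero a p = ∷-cong (coeff-scale a p 0) ~-refl
  revPad-scale (suc N) a p = ∷-cong (coeff-scale a p (suc N)) (revPad-scale N a p)

  snoc0 : ∀ Lst → Lst ++ (0# ∷ []) ~ Lst
  snoc0 [] = mk~ λ { zero → refl ; (suc i) → refl }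
  snoc0 (a ∷ Lst) = ∷-cong refl (snoc0 Lst)

  revPad-x : ∀ N p → revPad (suc N) (0# ∷ p) ~ revPad N p
  revPad-x N p = ~-trans (≡⇒~ (revPad-cons N 0# p)) (snoc0 (revPad N p))

  revPad-[] : ∀ N → revPad N [] ~ []
  revPad-[] zero = mk~ λ { zero → refl ; (suc i) → refl }
  revPad-[] (suc N) = mk~ λ { zero → refl ; (suc i) → un~ (revPad-[] N) i }

  revPad-up : ∀ j N p → Deg≤ p N → revPad (j ℕ.+ N) p ~ shift j (revPad N p)
  revPad-up zero N p d = ~-refl
  revPad-up (suc j) N p d = ∷-cong (d (suc (j ℕ.+ N)) (s≤s (ℕP.m≤n+m N j))) (revPad-up j N p d)

  revPad-mul : ∀ p q n m' → Deg≤ p n → Deg≤ q m' → revPad (n ℕ.+ m') (p ⊛ q) ~ revPad n p ⊛ revPad m' q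
  revPad-mul [] q n m' dp dq = ~-trans (≡⇒~ (revPad-cong (n ℕ.+ m') (~-refl {[]}))) (~-trans (revPad-[] (n ℕ.+ m')) (~-sym (⊛-zeroˡ (revPad n []) (revPad m' q) (revPad-[] n))))
  revPad-mul (a ∷ p) q zero m' dp dq = begin
      revPad m' ((a ∷ p) ⊛ q) ≡⟨ revPad-cong m' a∷p⊛q≈aq ⟩
      revPad m' (scale a q) ≈⟨ revPad-scale m' a q ⟩
      scale a (revPad m' q) ≈⟨ ~-sym (⊛-const a (revPad m' q)) ⟩
      (a ∷ []) ⊛ revPad m' q ∎
    where
    open SR ~-setoid
    p≈0 : p ~ []
    p≈0 = mk~ λ i → dp (suc i) (s≤s z≤n)
    a∷p⊛q≈aq : (a ∷ p) ⊛ q ~ scale a q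
    a∷p⊛q≈aq = ~-trans (⊕-cong (~-refl {scale a q}) (∷-cong refl (⊛-zeroˡ p q p≈0))) (~-trans (⊕-cong (~-refl {scale a q}) (mk~ λ { zero → refl ; (suc i) → refl })) (⊕-idʳ (scale a q)))
  revPad-mul (a ∷ p) q (suc n) m' dp dq = begin
      revPad (suc n ℕ.+ m') (scale a q ⊕ (0# ∷ (p ⊛ q))) ≈⟨ revPad-⊕ (suc n ℕ.+ m') (scale a q) (0# ∷ (p ⊛ q)) ⟩
      revPad (suc n ℕ.+ m') (scale a q) ⊕ revPad (suc (n ℕ.+ m')) (0# ∷ (p ⊛ q)) ≈⟨ ⊕-cong (revPad-scale (suc n ℕ.+ m') a q) (revPad-x (n ℕ.+ m') (p ⊛ q)) ⟩
      scale a (revPad (suc n ℕ.+ m') q) ⊕ revPad (n ℕ.+ m') (p ⊛ q) ≈⟨ ⊕-cong (scale-cong refl (revPad-up (suc n) m' q dq)) (revPad-mul p q n m' (λ i lt → dp (suc i) (s≤s lt)) dq) ⟩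
      scale a (shift (suc n) (revPad m' q)) ⊕ (revPad n p ⊛ revPad m' q) ≈⟨ ⊕-comm (scale a (shift (suc n) (revPad m' q))) (revPad n p ⊛ revPad m' q) ⟩
      (revPad n p ⊛ revPad m' q) ⊕ scale a (shift (suc n) (revPad m' q)) ≈⟨ ⊕-cong (~-refl {revPad n p ⊛ revPad m' q}) (~-trans (~-sym (shift-scale (suc n) a (revPad m' q))) (~-sym (~-trans (shift-⊛ˡ (suc n) (a ∷ []) (revPad m' q)) (shift-cong (suc n) (⊛-const a (revPad m' q)))))) ⟩
      (revPad n p ⊛ revPad m' q) ⊕ (shift (suc n) (a ∷ []) ⊛ revPad m' q) ≈⟨ ~-sym (⊛-distribʳ (revPad n p) (shift (suc n) (a ∷ [])) (revPad m' q)) ⟩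
      (revPad n p ⊕ shift (suc n) (a ∷ [])) ⊛ revPad m' q ≈⟨ ⊛-congˡ (revPad m' q) (~-sym (~-trans (≡⇒~ (revPad-cons n a p)) (~-trans (snoc-⊕ (revPad n p) a) (⊕-cong (~-refl {revPad n p}) (≡⇒~ (cong (λ z → replicate z 0# ++ (a ∷ [])) (length-revPad n p))))))) ⟩
      revPad (suc n) (a ∷ p) ⊛ revPad m' q ∎
    where
    open SR ~-setoid

  rec-cong : ∀ {p q} → p ~ q → p * ≡ q *
  rec-cong {p} {q} e = cong reverse (~⇒strip p q e)

  rec-mul : ∀ p q → Nonzero p → Nonzero q → (p ⊛ q) * ~ (p *) ⊛ (q *)
  rec-mul p q np nq with prod-strip p q np nq
  ... | P , Q , R , eP , eQ , eR , len =
    ~-trans (≡⇒~ (trans (rec-revPad (p ⊛ q) R eR) (cong (λ z → revPad z (p ⊛ q)) len)))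
     (~-trans (revPad-mul p q (length P) (length Q) (strip-deg p P eP) (strip-deg q Q eQ))
       (≡⇒~ (sym (cong₂ _⊛_ (rec-revPad p P eP) (rec-revPad q Q eQ)))))

  rec-nonzero : ∀ p → Nonzero p → Nonzero (p *)
  rec-nonzero p np z with nonzero-form p np
  ... | P , e = 1≢0 (trans (sym (cong (λ w → coeff w 0) (trans (cong reverse e) (reverse-++ P (1# ∷ []))))) (un~ z 0))

  rec-involutive : ∀ p → ¬ (coeff p 0 ≡ 0#) → (p *) * ~ p
  rec-involutive p ne = go (strip p) refl
    where
    go : ∀ S → strip p ≡ S → (p *) * ~ p
    go [] e = ⊥-elim (ne (trans (sym (un~ (strip-~ p) 0)) (cong (λ w → coeff w 0) e)))
    go (s ∷ S') e = ~-trans (≡⇒~ (trans (cong reverse (trans (cong strip r) (strip-canon (reverse S') s s≢0)))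
                             (trans (cong reverse (sym r)) (trans (reverse-involutive (strip p)) e)))) (~-trans (≡⇒~ (sym e)) (strip-~ p))
      where
      s≢0 : ¬ (s ≡ 0#)
      s≢0 z = ne (trans (sym (un~ (strip-~ p) 0)) (trans (cong (λ w → coeff w 0) e) z))
      r : p * ≡ reverse S' ++ (s ∷ [])
      r = trans (cong reverse e) (unfold-reverse s S')

  Φ-rec : ∀ a → (xⁿ-1 (suc a)) * ≡ xⁿ-1 (suc a)
  Φ-rec a = trans (cong reverse (strip-canon (1# ∷ replicate a 0#) 1# (λ ())))
    (trans (reverse-++ (1# ∷ replicate a 0#) (1# ∷ []))
      (cong (1# ∷_) (trans (unfold-reverse 1# (replicate a 0#)) (cong (_++ (1# ∷ [])) (reverse-rep a 0#)))))

  Φ-nonzero : ∀ a → Nonzero (xⁿ-1 (suc a))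
  Φ-nonzero a z = 1≢0 (un~ z 0)

  ∣-nonzero : ∀ d p → Nonzero p → d ∣~ p → Nonzero d
  ∣-nonzero d p np (q , e) z = np (~-trans e (~-trans (⊛-comm q d) (⊛-zeroˡ d q z)))

  ∣-coeff0 : ∀ d p → ¬ (coeff p 0 ≡ 0#) → d ∣~ p → ¬ (coeff d 0 ≡ 0#)
  ∣-coeff0 d p ne (q , e) z = ne (trans (un~ e 0) (trans (coeff0-⊛ q d) (trans (cong (coeff q 0 *_) z) (*-zeroʳ (coeff q 0)))))

  reciprocal-factorisation : ∀ a e d → xⁿ-1 (suc a) ~ e ⊛ d → (e *) ⊛ (d *) ~ xⁿ-1 (suc a)
  reciprocal-factorisation a e d eΦ = ~-sym (~-trans (≡⇒~ (trans (sym (Φ-rec a)) (rec-cong eΦ))) (rec-mul e d ne nd))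
    where
    ne : Nonzero e
    ne = ∣-nonzero e (xⁿ-1 (suc a)) (Φ-nonzero a) (d , ~-trans eΦ (⊛-comm e d))
    nd : Nonzero d
    nd = ∣-nonzero d (xⁿ-1 (suc a)) (Φ-nonzero a) (e , eΦ)

  cofactor-reciprocal-divides : ∀ a c b̄ p → xⁿ-1 (suc a) ~ c ⊛ b̄ → xⁿ-1 (suc a) ∣~ p ⊛ (b̄ *) → (c *) ∣~ p
  cofactor-reciprocal-divides a c b̄ p eΦ (w , e) = w , cancel (b̄ *) p (w ⊛ (c *)) (rec-nonzero b̄ nb̄)
     (~-trans (⊛-comm (b̄ *) p) (~-trans e (~-trans (⊛-congʳ w (~-sym (reciprocal-factorisation a c b̄ eΦ)))
        (solve 3 (λ W C' B' → (W :* (C' :* B')) ⊜ (B' :* (W :* C'))) ~-refl w (c *) (b̄ *)))))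
    where
    open NR polySolverRing₀ using (solve; _⊜_)
    nb̄ : Nonzero b̄
    nb̄ = ∣-nonzero b̄ (xⁿ-1 (suc a)) (Φ-nonzero a) (c , eΦ)

  -- Indeed (c̄b̄)(s·t*) = D·d* = c̄b̄
  -- forces s·t* = 1, and 1 is the only unit of ℤ₂[x].
  factorisation-rigid : ∀ a c̄ b̄ D d s t → xⁿ-1 (suc a) ~ c̄ ⊛ b̄ → D ⊛ (d *) ~ xⁿ-1 (suc a) →
    D ~ s ⊛ b̄ → d ~ t ⊛ (c̄ *) → D ~ b̄
  factorisation-rigid a c̄ b̄ D d s t eΦ eD eDs et = ~-trans eDs (~-trans (⊛-congˡ b̄ s≈1) (⊛-idˡ b̄))
    where
    open NR polySolverRing₀ using (solve; _⊜_)
    Φ≉0 : Nonzero (xⁿ-1 (suc a))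
    Φ≉0 = Φ-nonzero a
    c̄≉0 : Nonzero c̄
    c̄≉0 = ∣-nonzero c̄ (xⁿ-1 (suc a)) Φ≉0 (b̄ , ~-trans eΦ (⊛-comm c̄ b̄))
    c̄₀≢0 : ¬ (coeff c̄ 0 ≡ 0#)
    c̄₀≢0 = ∣-coeff0 c̄ (xⁿ-1 (suc a)) (λ ()) (b̄ , ~-trans eΦ (⊛-comm c̄ b̄))
    t≉0 : Nonzero t
    t≉0 z = Φ≉0 (~-trans (~-sym eD) (~-trans (⊛-comm D (d *)) (⊛-zeroˡ (d *) D (≡⇒~ (rec-cong (~-trans et (⊛-zeroˡ t (c̄ *) z)))))))
    d*≈t*c̄ : d * ~ (t *) ⊛ c̄
    d*≈t*c̄ = ~-trans (≡⇒~ (rec-cong et)) (~-trans (rec-mul t (c̄ *) t≉0 (rec-nonzero c̄ c̄≉0)) (⊛-congʳ (t *) (rec-involutive c̄ c̄₀≢0)))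
    cancellable : (c̄ ⊛ b̄) ⊛ (s ⊛ (t *)) ~ (c̄ ⊛ b̄) ⊛ (1# ∷ [])
    cancellable = ~-trans (solve 4 (λ C' B' S T' → ((C' :* B') :* (S :* T')) ⊜ ((S :* B') :* (T' :* C'))) ~-refl c̄ b̄ s (t *))
           (~-trans (⊛-cong (~-sym eDs) (~-sym d*≈t*c̄)) (~-trans eD (~-trans eΦ (~-sym (⊛-idʳ (c̄ ⊛ b̄))))))
    s≈1 : s ~ (1# ∷ [])
    s≈1 = unit s (t *) (cancel (c̄ ⊛ b̄) (s ⊛ (t *)) (1# ∷ []) (λ z → Φ≉0 (~-trans eΦ z)) cancellable)

module Quaternary where
  module B = Binary

  module Q = CyclicReduction 3 ℤ₄-laws
  open Q using () renaming (_~_ to _~₄_; _⊕_ to _⊕₄_; _⊛_ to _⊛₄_; scale to scale₄; neg to neg₄)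
  open B using (_~_; _⊕_; _⊛_)

  red-+ : ∀ a b → red₂ (a Q.+ b) ≡ red₂ a B.+ red₂ b
  red-+ = toWitness {a? = Eq₂? (λ a b → red₂ (a Q.+ b)) (λ a b → red₂ a B.+ red₂ b)} _

  red-* : ∀ a b → red₂ (a Q.* b) ≡ red₂ a B.* red₂ b
  red-* = toWitness {a? = Eq₂? (λ a b → red₂ (a Q.* b)) (λ a b → red₂ a B.* red₂ b)} _

  half : Fin 4 → Fin 2
  half zero = zero
  half (suc zero) = zero
  half (suc (suc zero)) = suc zero
  half (suc (suc (suc zero))) = suc zero

  even≡two*half : ∀ a → red₂ a ≡ zero → a ≡ two₄ Q.* ι (half a)
  even≡two*half zero e = refl
  even≡two*half (suc zero) ()
  even≡two*half (suc (suc zero)) e = refl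
  even≡two*half (suc (suc (suc zero))) ()

  two*≡0⇒even : ∀ a → two₄ Q.* a ≡ zero → red₂ a ≡ zero
  two*≡0⇒even zero e = refl
  two*≡0⇒even (suc zero) ()
  two*≡0⇒even (suc (suc zero)) e = refl
  two*≡0⇒even (suc (suc (suc zero))) ()

  two*two*≡0 : ∀ a → two₄ Q.* (two₄ Q.* a) ≡ zero
  two*two*≡0 zero = refl
  two*two*≡0 (suc zero) = refl
  two*two*≡0 (suc (suc zero)) = refl
  two*two*≡0 (suc (suc (suc zero))) = refl

  red-ι : ∀ a → red₂ (ι a) ≡ a
  red-ι zero = refl
  red-ι (suc zero) = refl

  lift : B.Pol → Q.Pol
  lift = map ι

  red-⊕ : ∀ p q → red₂ₚ (p ⊕₄ q) ≡ red₂ₚ p ⊕ red₂ₚ q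
  red-⊕ [] q = refl
  red-⊕ (a ∷ p) [] = refl
  red-⊕ (a ∷ p) (b ∷ q) = cong₂ _∷_ (red-+ a b) (red-⊕ p q)

  red-scale : ∀ a p → red₂ₚ (scale₄ a p) ≡ B.scale (red₂ a) (red₂ₚ p)
  red-scale a [] = refl
  red-scale a (b ∷ p) = cong₂ _∷_ (red-* a b) (red-scale a p)

  red-⊛ : ∀ p q → red₂ₚ (p ⊛₄ q) ≡ red₂ₚ p ⊛ red₂ₚ q
  red-⊛ [] q = refl
  red-⊛ (a ∷ p) q = trans (red-⊕ (scale₄ a q) (zero ∷ (p ⊛₄ q))) (cong₂ _⊕_ (red-scale a q) (cong (zero ∷_) (red-⊛ p q)))

  coeff-red : ∀ p n → B.coeff (red₂ₚ p) n ≡ red₂ (Q.coeff p n)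
  coeff-red [] n = refl
  coeff-red (a ∷ p) zero = refl
  coeff-red (a ∷ p) (suc n) = coeff-red p n

  coeff-lift : ∀ P n → Q.coeff (lift P) n ≡ ι (B.coeff P n)
  coeff-lift [] n = refl
  coeff-lift (a ∷ P) zero = refl
  coeff-lift (a ∷ P) (suc n) = coeff-lift P n

  red-cong : ∀ {p q} → p ~₄ q → red₂ₚ p ~ red₂ₚ q
  red-cong {p} {q} e = B.mk~ λ n → trans (coeff-red p n) (trans (cong red₂ (Q.un~ e n)) (sym (coeff-red q n)))

  red-lift : ∀ P → red₂ₚ (lift P) ≡ P
  red-lift [] = refl
  red-lift (a ∷ P) = cong₂ _∷_ (red-ι a) (red-lift P)

  red-neg : ∀ p → red₂ₚ (neg₄ p) ~ red₂ₚ p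
  red-neg p = B.~-trans (B.≡⇒~ (red-scale (Q.- Q.1#) p)) (B.~-trans (B.scale-cong refl (B.~-refl {red₂ₚ p})) (B.scale-1 (red₂ₚ p)))

  halfₚ : Q.Pol → B.Pol
  halfₚ = map half

  even⇒two*half : ∀ p → red₂ₚ p ~ [] → p ~₄ scale₄ two₄ (lift (halfₚ p))
  even⇒two*half p e = Q.mk~ λ n → trans (even≡two*half (Q.coeff p n) (trans (sym (coeff-red p n)) (B.un~ e n)))
    (sym (trans (Q.coeff-scale two₄ (lift (halfₚ p)) n) (cong (two₄ Q.*_) (trans (coeff-lift (halfₚ p) n) (cong ι (ch p n))))))
    where
    ch : ∀ p n → B.coeff (halfₚ p) n ≡ half (Q.coeff p n)
    ch [] n = refl
    ch (a ∷ p) zero = refl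
    ch (a ∷ p) (suc n) = ch p n

  scale-two≈0⇒even : ∀ p → scale₄ two₄ p ~₄ [] → red₂ₚ p ~ []
  scale-two≈0⇒even p e = B.mk~ λ n → trans (coeff-red p n) (two*≡0⇒even (Q.coeff p n) (trans (sym (Q.coeff-scale two₄ p n)) (Q.un~ e n)))

  scale-two-two≈0 : ∀ p → scale₄ two₄ (scale₄ two₄ p) ~₄ []
  scale-two-two≈0 p = Q.mk~ λ n → trans (Q.coeff-scale two₄ (scale₄ two₄ p) n) (trans (cong (two₄ Q.*_) (Q.coeff-scale two₄ p n)) (two*two*≡0 (Q.coeff p n)))

  red-snoc : ∀ r c → red₂ₚ (r ++ (c ∷ [])) ≡ red₂ₚ r ++ (red₂ c ∷ [])
  red-snoc [] c = refl
  red-snoc (a ∷ r) c = cong (red₂ a ∷_) (red-snoc r c)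

  monic-reduction-nonzero : ∀ h → P4.Monic h → B.Nonzero (red₂ₚ h)
  monic-reduction-nonzero h (r , e) z = B.canonical-nonzero (red₂ₚ r) (B.~-trans (B.≡⇒~ (sym (trans (cong red₂ₚ e) (red-snoc r Q.1#)))) (B.~-trans (red-cong (Q.strip-~ h)) z))

  open NR Q.polySolverRing₀ using () renaming (solve to solve₄; _⊜_ to _⊜₄_)
  open NR B.polySolverRing₀ using () renaming (solve to solve₂; _⊜_ to _⊜₂_)

  two : Q.Pol
  two = two₄ ∷ []

  red-coprime : ∀ u v g h → u ⊛₄ g ⊕₄ v ⊛₄ h P4.≈ Q.const Q.1# → red₂ₚ u ⊛ red₂ₚ g ⊕ red₂ₚ v ⊛ red₂ₚ h ~ (B.1# ∷ [])
  red-coprime u v g h e = B.~-trans (B.≡⇒~ (sym (trans (red-⊕ (u ⊛₄ g) (v ⊛₄ h)) (cong₂ _⊕_ (red-⊛ u g) (red-⊛ v h))))) (red-cong (Q.≈⇒~ {u ⊛₄ g ⊕₄ v ⊛₄ h} {Q.const Q.1#} e))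

  monic-cancelˡ : ∀ f A C → P4.Monic f → f ⊛₄ A ~₄ f ⊛₄ C → A ~₄ C
  monic-cancelˡ f A C mf e = Q.⊕-neg⇒ A C (Q.monic-cancel f (A ⊕₄ neg₄ C) mf
     (Q.~-trans (solve₄ 3 (λ F' A' C' → (F' :* (A' :+ (:- C'))) ⊜₄ (F' :* A' :+ (:- (F' :* C')))) Q.~-refl f A C)
       (Q.~-trans (Q.⊕-cong e (Q.~-refl {neg₄ (f ⊛₄ C)})) (Q.⊕-neg (f ⊛₄ C)))))

  same-reduction⇒even-difference : ∀ p q → red₂ₚ p ~ red₂ₚ q → p ~₄ q ⊕₄ two ⊛₄ lift (halfₚ (p ⊕₄ neg₄ q))
  same-reduction⇒even-difference p q e =
    Q.~-trans (solve₄ 2 (λ P Q' → P ⊜₄ (Q' :+ (P :+ (:- Q')))) Q.~-refl p q)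
      (Q.⊕-cong (Q.~-refl {q}) (Q.~-trans (even⇒two*half (p ⊕₄ neg₄ q) red0) (Q.~-sym (Q.⊛-const two₄ _))))
    where
    red0 : red₂ₚ (p ⊕₄ neg₄ q) ~ []
    red0 = B.~-trans (B.≡⇒~ (red-⊕ p (neg₄ q))) (B.~-trans (B.⊕-cong e (red-neg q)) (B.char2 (red₂ₚ q)))

  two-two⊛ : ∀ x → two ⊛₄ (two ⊛₄ x) ~₄ []
  two-two⊛ x = Q.~-trans (Q.⊛-congʳ two (Q.⊛-const two₄ x)) (Q.~-trans (Q.⊛-const two₄ (scale₄ two₄ x)) (scale-two-two≈0 x))

  two⊛≈0⇒even : ∀ p → two ⊛₄ p ~₄ [] → red₂ₚ p ~ []
  two⊛≈0⇒even p e = scale-two≈0⇒even p (Q.~-trans (Q.~-sym (Q.⊛-const two₄ p)) e)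

  -- First step of the kernel computation: cancelling the monic factor f from
  -- μ·f(h+2) ≡ 0 mod fgh leaves μ(h+2) = gh·Y.
  cancel-f : ∀ k (f g h μ : Q.Pol) → P4.Monic f →
     ((f ⊛₄ g) ⊛₄ h) P4.≈ P4.xⁿ-1 (suc k) →
     (∀ j → zero ≡ P4.vec (suc k) (μ ⊛₄ genF f h) j) →
     Σ Q.Pol λ Y → μ ⊛₄ (h ⊕₄ two) ~₄ (g ⊛₄ h) ⊛₄ Y
  cancel-f k f g h μ mf efgh vz = Y , monic-cancelˡ f _ _ mf (begin
      f ⊛₄ (μ ⊛₄ (h ⊕₄ two))   ≈⟨ solve₄ 3 (λ F' M H' → (F' :* (M :* H')) ⊜₄ (M :* (F' :* H'))) Q.~-refl f μ (h ⊕₄ two) ⟩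
      μ ⊛₄ (f ⊛₄ (h ⊕₄ two))   ≈⟨ Q.⊛-congʳ μ (Q.~-trans (Q.⊛-distribˡ f h two) (Q.⊕-cong (Q.~-refl {f ⊛₄ h}) (Q.⊛-constʳ two₄ f))) ⟩
      μ ⊛₄ genF f h             ≈⟨ eY ⟩
      Y ⊛₄ Φ                    ≈⟨ Q.⊛-congʳ Y (Q.~-sym (Q.≈⇒~ efgh)) ⟩
      Y ⊛₄ ((f ⊛₄ g) ⊛₄ h)     ≈⟨ solve₄ 4 (λ Y' F' G' H' → (Y' :* ((F' :* G') :* H')) ⊜₄ (F' :* ((G' :* H') :* Y'))) Q.~-refl Y f g h ⟩
      f ⊛₄ ((g ⊛₄ h) ⊛₄ Y)     ∎)
    where
    open SR Q.~-setoid
    Φ = P4.xⁿ-1 (suc k)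
    Y : Q.Pol
    Y = proj₁ (Q.vec0⇒∣ k (μ ⊛₄ genF f h) (λ j → sym (vz j)))
    eY : μ ⊛₄ genF f h ~₄ Y ⊛₄ Φ
    eY = proj₂ (Q.vec0⇒∣ k (μ ⊛₄ genF f h) (λ j → sym (vz j)))

  -- Reducing μ(h+2) = gh·Y modulo 2 and cancelling h gives μ ≡ g·Y (mod 2).
  reduce-mod-2 : ∀ (g h μ Y : Q.Pol) → P4.Monic h → μ ⊛₄ (h ⊕₄ two) ~₄ (g ⊛₄ h) ⊛₄ Y →
     red₂ₚ μ ~ red₂ₚ g ⊛ red₂ₚ Y
  reduce-mod-2 g h μ Y mh e = B.cancel h' μ' (g' ⊛ Y') (monic-reduction-nonzero h mh) (begin
      h' ⊛ μ'                ≈⟨ B.⊛-comm h' μ' ⟩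
      μ' ⊛ h'                ≈⟨ B.⊛-congʳ μ' (B.~-sym h+2≡h) ⟩
      μ' ⊛ red₂ₚ (h ⊕₄ two)  ≡⟨ sym (red-⊛ μ (h ⊕₄ two)) ⟩
      red₂ₚ (μ ⊛₄ (h ⊕₄ two)) ≈⟨ red-cong e ⟩
      red₂ₚ ((g ⊛₄ h) ⊛₄ Y)  ≡⟨ trans (red-⊛ (g ⊛₄ h) Y) (cong (_⊛ Y') (red-⊛ g h)) ⟩
      (g' ⊛ h') ⊛ Y'         ≈⟨ solve₂ 3 (λ G H Yv → ((G :* H) :* Yv) ⊜₂ (H :* (G :* Yv))) B.~-refl g' h' Y' ⟩
      h' ⊛ (g' ⊛ Y')         ∎)
    where
    open SR B.~-setoid
    g' h' μ' Y' : B.Pol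
    g' = red₂ₚ g
    h' = red₂ₚ h
    μ' = red₂ₚ μ
    Y' = red₂ₚ Y
    h+2≡h : red₂ₚ (h ⊕₄ two) ~ h'
    h+2≡h = B.~-trans (B.≡⇒~ (red-⊕ h two)) (B.~-trans (B.⊕-cong (B.~-refl {h'}) (B.mk~ λ { zero → refl ; (suc i) → refl })) (B.⊕-idʳ h'))

  -- The 2-adic identity behind the kernel lemma: if (gỸ + 2r)(h + 2) = ghY and
  -- Y − Ỹ = 2Z, then 2(gỸ + rh) = 2·ghZ, since 4 = 0.
  twice-identity : ∀ (g h Ỹ r Y Z : Q.Pol) → (g ⊛₄ Ỹ ⊕₄ two ⊛₄ r) ⊛₄ (h ⊕₄ two) ~₄ (g ⊛₄ h) ⊛₄ Y →
     Y ⊕₄ neg₄ Ỹ ~₄ two ⊛₄ Z → two ⊛₄ (g ⊛₄ Ỹ ⊕₄ r ⊛₄ h) ~₄ two ⊛₄ ((g ⊛₄ h) ⊛₄ Z)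
  twice-identity g h Ỹ r Y Z e Y-split = begin
      two ⊛₄ A                                               ≈⟨ solve₄ 2 (λ X B' → B' ⊜₄ ((X :+ B') :+ (:- X))) Q.~-refl ((g ⊛₄ h) ⊛₄ Ỹ) (two ⊛₄ A) ⟩
      ((g ⊛₄ h) ⊛₄ Ỹ ⊕₄ two ⊛₄ A) ⊕₄ neg₄ ((g ⊛₄ h) ⊛₄ Ỹ) ≈⟨ Q.⊕-cong expand (Q.~-refl {neg₄ ((g ⊛₄ h) ⊛₄ Ỹ)}) ⟩
      (g ⊛₄ h) ⊛₄ Y ⊕₄ neg₄ ((g ⊛₄ h) ⊛₄ Ỹ)               ≈⟨ solve₄ 3 (λ GH Y0 K → (GH :* Y0 :+ (:- (GH :* K))) ⊜₄ (GH :* (Y0 :+ (:- K)))) Q.~-refl (g ⊛₄ h) Y Ỹ ⟩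
      (g ⊛₄ h) ⊛₄ (Y ⊕₄ neg₄ Ỹ)                            ≈⟨ Q.⊛-congʳ (g ⊛₄ h) Y-split ⟩
      (g ⊛₄ h) ⊛₄ (two ⊛₄ Z)                               ≈⟨ solve₄ 3 (λ GH T' Z' → (GH :* (T' :* Z')) ⊜₄ (T' :* (GH :* Z'))) Q.~-refl (g ⊛₄ h) two Z ⟩
      two ⊛₄ ((g ⊛₄ h) ⊛₄ Z)                                ∎
    where
    open SR Q.~-setoid
    A : Q.Pol
    A = g ⊛₄ Ỹ ⊕₄ r ⊛₄ h
    -- expanding (gỸ + 2r)(h + 2) = ghỸ + 2A + 4r
    expand : (g ⊛₄ h) ⊛₄ Ỹ ⊕₄ two ⊛₄ A ~₄ (g ⊛₄ h) ⊛₄ Y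
    expand = Q.~-trans (Q.~-sym (Q.~-trans (solve₄ 5 (λ G' H' K R T' → (((G' :* K) :+ (T' :* R)) :* (H' :+ T')) ⊜₄ (((G' :* H') :* K :+ T' :* ((G' :* K) :+ R :* H')) :+ T' :* (T' :* R))) Q.~-refl g h Ỹ r two)
              (Q.~-trans (Q.⊕-cong (Q.~-refl {(g ⊛₄ h) ⊛₄ Ỹ ⊕₄ two ⊛₄ A}) (two-two⊛ r)) (Q.⊕-idʳ _)))) e

  -- The second-order part of the kernel computation: writing μ = gỸ + 2r and
  -- Y = Ỹ + 2Z for the lift Ỹ of Y mod 2, the identity above gives
  -- gY + rh ≡ ghZ (mod 2), so h divides g·Y modulo 2.
  second-order : ∀ (g h μ Y : Q.Pol) → μ ⊛₄ (h ⊕₄ two) ~₄ (g ⊛₄ h) ⊛₄ Y →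
     red₂ₚ μ ~ red₂ₚ g ⊛ red₂ₚ Y →
     Σ B.Pol λ R → red₂ₚ g ⊛ red₂ₚ Y ~ red₂ₚ h ⊛ R
  second-order g h μ Y e μ≡gY = r' ⊕ g' ⊛ Z' , B.⊕⇒~ (g' ⊛ Y') (h' ⊛ (r' ⊕ g' ⊛ Z')) (B.~-trans
      (solve₂ 5 (λ G' Yv R H' Zv → (G' :* Yv :+ H' :* (R :+ G' :* Zv)) ⊜₂ ((G' :* Yv :+ R :* H') :+ (G' :* H') :* Zv)) B.~-refl g' Y' r' h' Z')
      (B.~-trans (B.⊕-cong (B.~-sym redA) (B.~-sym redB)) (B.~-trans (B.≡⇒~ (sym (red-⊕ A (neg₄ Bq)))) A≡Bq)))
    where
    g' h' Y' : B.Pol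
    g' = red₂ₚ g
    h' = red₂ₚ h
    Y' = red₂ₚ Y
    Ỹ : Q.Pol
    Ỹ = lift Y'
    red-gỸ : red₂ₚ (g ⊛₄ Ỹ) ~ g' ⊛ Y'
    red-gỸ = B.≡⇒~ (trans (red-⊛ g Ỹ) (cong (g' ⊛_) (red-lift Y')))
    r Z A Bq : Q.Pol
    r = lift (halfₚ (μ ⊕₄ neg₄ (g ⊛₄ Ỹ)))
    Z = lift (halfₚ (Y ⊕₄ neg₄ Ỹ))
    A = g ⊛₄ Ỹ ⊕₄ r ⊛₄ h
    Bq = (g ⊛₄ h) ⊛₄ Z
    μ-split : μ ~₄ g ⊛₄ Ỹ ⊕₄ two ⊛₄ r
    μ-split = same-reduction⇒even-difference μ (g ⊛₄ Ỹ) (B.~-trans μ≡gY (B.~-sym red-gỸ))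
    Y-split : Y ⊕₄ neg₄ Ỹ ~₄ two ⊛₄ Z
    Y-split = Q.~-trans (Q.⊕-cong (same-reduction⇒even-difference Y Ỹ (B.≡⇒~ (sym (red-lift Y')))) (Q.~-refl {neg₄ Ỹ}))
      (solve₄ 2 (λ Y~ X → ((Y~ :+ X) :+ (:- Y~)) ⊜₄ X) Q.~-refl Ỹ (two ⊛₄ Z))
    A≡Bq : red₂ₚ (A ⊕₄ neg₄ Bq) ~ []
    A≡Bq = two⊛≈0⇒even (A ⊕₄ neg₄ Bq)
      (Q.~-trans (solve₄ 3 (λ T' A' B' → (T' :* (A' :+ (:- B'))) ⊜₄ (T' :* A' :+ (:- (T' :* B')))) Q.~-refl two A Bq)
        (Q.~⇒⊕-neg (two ⊛₄ A) (two ⊛₄ Bq) (twice-identity g h Ỹ r Y Z (Q.~-trans (Q.⊛-congˡ (h ⊕₄ two) (Q.~-sym μ-split)) e) Y-split)))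
    r' Z' : B.Pol
    r' = red₂ₚ r
    Z' = red₂ₚ Z
    redA : red₂ₚ A ~ (g' ⊛ Y') ⊕ r' ⊛ h'
    redA = B.~-trans (B.≡⇒~ (red-⊕ (g ⊛₄ Ỹ) (r ⊛₄ h))) (B.⊕-cong red-gỸ (B.≡⇒~ (red-⊛ r h)))
    redB : red₂ₚ (neg₄ Bq) ~ (g' ⊛ h') ⊛ Z'
    redB = B.~-trans (red-neg Bq) (B.≡⇒~ (trans (red-⊛ (g ⊛₄ h) Z) (cong (_⊛ Z') (red-⊛ g h))))

  kernel : ∀ k (f g h μ : Q.Pol) → P4.Monic f → P4.Monic h → P4.Coprime g h →
     ((f ⊛₄ g) ⊛₄ h) P4.≈ P4.xⁿ-1 (suc k) →
     (∀ j → zero ≡ P4.vec (suc k) (μ ⊛₄ genF f h) j) →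
     Σ B.Pol λ W → red₂ₚ μ ~ red₂ₚ (g ⊛₄ h) ⊛ W
  kernel k f g h μ mf mh (u , v , bézout) efgh vz =
    let (Y , eY) = cancel-f k f g h μ mf efgh vz
        μ≡gY = reduce-mod-2 g h μ Y mh eY
        (R , gY≡hR) = second-order g h μ Y eY μ≡gY
        (W , Y≡hW) = B.coprime-divides (red₂ₚ u) (red₂ₚ v) (red₂ₚ g) (red₂ₚ h) (red₂ₚ Y) R (red-coprime u v g h bézout) gY≡hR
    in W , B.~-trans μ≡gY (B.~-trans (B.⊛-congʳ (red₂ₚ g) Y≡hW)
             (B.~-trans (B.~-sym (B.⊛-assoc (red₂ₚ g) (red₂ₚ h) W)) (B.≡⇒~ (cong (_⊛ W) (sym (red-⊛ g h))))))

module Duality where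
  open Binary
  module K = Quaternary
  module Q = K.Q
  module Q4 = CyclicPairing 3 ℤ₄-laws
  open NR polySolverRing₀ using (solve; _⊜_)
  open NR Q.polySolverRing₀ using () renaming (solve to solve₄; _⊜_ to _⊜₄_)

  -- A bit c viewed as the element 2c of ℤ₄: binary coordinates enter the
  -- inner product only through 2·u_i·v_i, which is additive in the bits.
  twice : Fin 2 → Fin 4
  twice c = two₄ P4.* ι c

  twice-+ : ∀ x y → twice (x P2.+ y) ≡ twice x P4.+ twice y
  twice-+ zero zero = refl
  twice-+ zero (suc zero) = refl
  twice-+ (suc zero) zero = refl
  twice-+ (suc zero) (suc zero) = refl

  twice-* : ∀ x y → two₄ P4.* (ι x P4.* ι y) ≡ twice (x P2.* y)
  twice-* zero zero = refl
  twice-* zero (suc zero) = refl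
  twice-* (suc zero) zero = refl
  twice-* (suc zero) (suc zero) = refl

  twice-injective : ∀ x → twice x ≡ zero → x ≡ zero
  twice-injective zero e = refl
  twice-injective (suc zero) ()

  sum-twice : ∀ n (x y : Fin n → Fin 2) → P4.sumV n (λ i → two₄ P4.* (ι (x i) P4.* ι (y i))) ≡ twice (P2.sumV n (λ i → x i P2.* y i))
  sum-twice zero x y = refl
  sum-twice (suc n) x y = trans (cong₂ P4._+_ (twice-* (x zero) (y zero)) (sum-twice n (λ i → x (suc i)) (λ i → y (suc i)))) (sym (twice-+ (x zero P2.* y zero) _))

  binaryWord : ∀ {α β} → Pol → Word α β
  binaryWord {α} V = vec α V , (λ _ → zero)

  inner-binaryWord : ∀ {α β} (u : Fin α → Fin 2) (u' : Fin β → Fin 4) V →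
    inner (u , u') (binaryWord {α} {β} V) ≡ twice (P2.sumV α (λ i → u i P2.* P2.vec α V i))
  inner-binaryWord {α} {β} u u' V = trans (cong₂ P4._+_ (sum-twice α u (P2.vec α V)) (Q4.sumV-0 β _ (λ j → Q.*-zeroʳ (u' j)))) (Q.+-idʳ _)

  module BinaryWords (a k : ℕ) (b ℓ : Pol) (f h : Q.Pol) where
    open Cyclic a
    α β : ℕ
    α = suc a
    β = suc k

    C : Code α β
    C = Gen α β b ℓ (genF f h)

    binaryPart : Q.Pol → Q.Pol → Pol
    binaryPart λ' μ = (red₂ₚ λ' ⊛ b) ⊕ (red₂ₚ μ ⊛ ℓ)

    generator∈C : ∀ λ' μ → C (genWord α β b ℓ (genF f h) λ' μ)
    generator∈C λ' μ = λ' , μ , (λ i → refl) , (λ j → refl)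

    b∈C : C (binaryWord b)
    b∈C = (P4.1# ∷ []) , [] , (λ i → sym (vec-cong α _ b (~-trans (⊕-idʳ ((1# ∷ []) ⊛ b)) (⊛-idˡ b)) i)) , (λ j → refl)

    orthogonal⇒dual : ∀ V → (∀ λ' μ → pair (binaryPart λ' μ) V ≡ 0#) → Dual C (binaryWord V)
    orthogonal⇒dual V o (u , u') (λ' , μ , e₁ , e₂) =
      trans (inner-binaryWord u u' V) (cong twice (trans (sumV-cong α _ _ (λ i → cong (λ z → z * vec α V i) (e₁ i))) (o λ' μ)))

    dual⇒orthogonal : ∀ V → Dual C (binaryWord V) → ∀ λ' μ → pair (binaryPart λ' μ) V ≡ 0#
    dual⇒orthogonal V dV λ' μ = twice-injective _
      (trans (sym (inner-binaryWord (vec α (binaryPart λ' μ)) (P4.vec β (μ P4.⊛ genF f h)) V)) (dV _ (generator∈C λ' μ)))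

    dual⇒orthogonal-b : ∀ V → Dual C (binaryWord V) → Orthogonal b V
    dual⇒orthogonal-b V dV = multiples⇒orthogonal b V λ s →
      trans (pair-congˡ (s ⊛ b) _ V (~-sym (~-trans (⊕-idʳ (red₂ₚ (K.lift s) ⊛ b)) (≡⇒~ (cong (_⊛ b) (K.red-lift s))))))
            (dual⇒orthogonal V dV (K.lift s) [])

    dual⇒orthogonal-ℓ : ∀ V → Dual C (binaryWord V) → Orthogonal ℓ V
    dual⇒orthogonal-ℓ V dV = multiples⇒orthogonal ℓ V λ s →
      trans (pair-congˡ (s ⊛ ℓ) _ V (≡⇒~ (cong (_⊛ ℓ) (sym (K.red-lift s))))) (dual⇒orthogonal V dV [] (K.lift s))

    -- Every binary part is a multiple of a common divisor d of b and ℓ, so a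
    -- word orthogonal to all multiples of d is in the dual.
    common-divisor⇒dual : ∀ d V → d P2.∣ b → d P2.∣ ℓ → (∀ s → pair (s ⊛ d) V ≡ 0#) → Dual C (binaryWord V)
    common-divisor⇒dual d V d∣b d∣ℓ o = orthogonal⇒dual V λ λ' μ → trans (pair-congˡ _ _ V (factor λ' μ)) (o ((red₂ₚ λ' ⊛ k₁) ⊕ (red₂ₚ μ ⊛ k₂)))
      where
      k₁ k₂ : Pol
      k₁ = proj₁ (∣⇒∣~ {d} {b} d∣b)
      k₂ = proj₁ (∣⇒∣~ {d} {ℓ} d∣ℓ)
      factor : ∀ λ' μ → binaryPart λ' μ ~ ((red₂ₚ λ' ⊛ k₁) ⊕ (red₂ₚ μ ⊛ k₂)) ⊛ d
      factor λ' μ = ~-trans (⊕-cong (⊛-congʳ (red₂ₚ λ') (proj₂ (∣⇒∣~ {d} {b} d∣b))) (⊛-congʳ (red₂ₚ μ) (proj₂ (∣⇒∣~ {d} {ℓ} d∣ℓ))))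
        (solve 5 (λ L K1 M K2 Dd → (L :* (K1 :* Dd) :+ M :* (K2 :* Dd)) ⊜ ((L :* K1 :+ M :* K2) :* Dd)) ~-refl (red₂ₚ λ') k₁ (red₂ₚ μ) k₂ d)

    -- For a generating set in standard form the binary words of C are
    -- multiples of b: the quaternary part forces μ ≡ gh·W (mod 2), and b
    -- divides gh·ℓ (mod 2) by the standard-form condition.
    binaryWord⇒multiple : ∀ g → StdForm α β b ℓ f g h → ∀ D → C (binaryWord D) → b ∣~ D
    binaryWord⇒multiple g (mf , _ , mh , _ , _ , cgh , efgh , b∣Φ , _ , cond) D (λ' , μ , eD , e0) =
      (cb ⊛ Qd) ⊕ (red₂ₚ λ' ⊕ (W ⊛ q)) , (begin
        D                                              ≈⟨ proj₂ (vec≡⇒congruent a D (binaryPart λ' μ) eD) ⟩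
        (Φ α ⊛ Qd) ⊕ binaryPart λ' μ                   ≈⟨ ⊕-cong (⊛-congˡ Qd eΦ) binaryPart≈ ⟩
        ((cb ⊛ b) ⊛ Qd) ⊕ (red₂ₚ λ' ⊕ (W ⊛ q)) ⊛ b     ≈⟨ solve 4 (λ C' B' Q' R → ((C' :* B') :* Q' :+ R :* B') ⊜ ((C' :* Q' :+ R) :* B')) ~-refl cb b Qd (red₂ₚ λ' ⊕ (W ⊛ q)) ⟩
        ((cb ⊛ Qd) ⊕ (red₂ₚ λ' ⊕ (W ⊛ q))) ⊛ b         ∎)
      where
      open SR ~-setoid
      cb : Pol
      cb = proj₁ (∣⇒∣~ {b} {Φ α} b∣Φ)
      eΦ : Φ α ~ cb ⊛ b
      eΦ = proj₂ (∣⇒∣~ {b} {Φ α} b∣Φ)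
      Qd : Pol
      Qd = proj₁ (vec≡⇒congruent a D (binaryPart λ' μ) eD)
      W : Pol
      W = proj₁ (K.kernel k f g h μ mf mh cgh efgh e0)
      μ≡ghW : red₂ₚ μ ~ red₂ₚ (g P4.⊛ h) ⊛ W
      μ≡ghW = proj₂ (K.kernel k f g h μ mf mh cgh efgh e0)
      b∣ghℓ : b ∣~ red₂ₚ (g P4.⊛ h) ⊛ ℓ
      b∣ghℓ = ∣⇒∣~ {b} {red₂ₚ (g P4.⊛ h) ⊛ ℓ} (cond (g P4.⊛ h) (Q.~⇒≈ (Q.~-trans
        (solve₄ 3 (λ G H F' → ((G :* H) :* F') ⊜₄ ((F' :* G) :* H)) Q.~-refl g h f) (Q.≈⇒~ {(f P4.⊛ g) P4.⊛ h} {P4.xⁿ-1 β} efgh))))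
      q : Pol
      q = proj₁ b∣ghℓ
      binaryPart≈ : binaryPart λ' μ ~ (red₂ₚ λ' ⊕ (W ⊛ q)) ⊛ b
      binaryPart≈ = ~-trans (⊕-cong (~-refl {red₂ₚ λ' ⊛ b}) (~-trans (⊛-congˡ ℓ μ≡ghW)
           (~-trans (solve 3 (λ G W' L → ((G :* W') :* L) ⊜ (W' :* (G :* L))) ~-refl (red₂ₚ (g P4.⊛ h)) W ℓ) (⊛-congʳ W (proj₂ b∣ghℓ)))))
         (solve 4 (λ L B' W' Q' → (L :* B' :+ W' :* (Q' :* B')) ⊜ ((L :+ W' :* Q') :* B')) ~-refl (red₂ₚ λ') b W q)

  module Proof (a k : ℕ) (b ℓ : Pol) (f h : Q.Pol) (b̄ ℓ̄ : Pol) (f̄ h̄ : Q.Pol)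
    (dual : ∀ w → Dual (Gen (suc a) (suc k) b ℓ (genF f h)) w ⇔ Gen (suc a) (suc k) b̄ ℓ̄ (genF f̄ h̄) w)
    (d : Pol) (gcd : P2.IsGCD d b ℓ) where
    open Cyclic a
    module 𝒞 = BinaryWords a k b ℓ f h
    module 𝒞̄ = BinaryWords a k b̄ ℓ̄ f̄ h̄

    -- (b̄ | 0) ∈ C̄ = C^⊥ is orthogonal to all shifts of b and of ℓ, so with
    -- x^α - 1 = c̄·b̄ the reciprocal c̄* divides b and ℓ, hence divides d.
    cofactor*∣gcd : ∀ c̄ → Φ (suc a) ~ c̄ ⊛ b̄ → (c̄ *) ∣~ d
    cofactor*∣gcd c̄ eΦ = ∣⇒∣~ {c̄ *} {d} (proj₂ (proj₂ gcd) (c̄ *) (∣~⇒∣ {c̄ *} {b} (divides b 𝒞.dual⇒orthogonal-b)) (∣~⇒∣ {c̄ *} {ℓ} (divides ℓ 𝒞.dual⇒orthogonal-ℓ)))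
      where
      b̄⊥C : Dual 𝒞.C (binaryWord b̄)
      b̄⊥C = Equivalence.from (dual (binaryWord b̄)) 𝒞̄.b∈C
      divides : ∀ p → (∀ V → Dual 𝒞.C (binaryWord V) → Orthogonal p V) → (c̄ *) ∣~ p
      divides p orth = cofactor-reciprocal-divides a c̄ b̄ p eΦ (orthogonal⇒reciprocal-divisible p b̄ (orthogonal-sym p b̄ (orth b̄ b̄⊥C)))

    reciprocal-cofactor∈dual : ∀ D → D ⊛ (d *) ~ Φ (suc a) → 𝒞̄.C (binaryWord D)
    reciprocal-cofactor∈dual D eD = Equivalence.to (dual (binaryWord D))
      (𝒞.common-divisor⇒dual d D (proj₁ gcd) (proj₁ (proj₂ gcd)) (reciprocal-cofactor⇒orthogonal D d eD))

mainTheorem8 : (α β : ℕ) → 1 ≤ α → β % 2 ≡ 1 →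
    (b ℓ : P2.Pol) (f g h : P4.Pol) → StdForm α β b ℓ f g h →
    (b̄ ℓ̄ : P2.Pol) (f̄ ḡ h̄ : P4.Pol) → StdForm α β b̄ ℓ̄ f̄ ḡ h̄ →
    (∀ w → Dual (Gen α β b ℓ (genF f h)) w ⇔ Gen α β b̄ ℓ̄ (genF f̄ h̄) w) →
    (d : P2.Pol) → P2.IsGCD d b ℓ →
    b̄ P2.⊛ (d P2.*) P2.≈ P2.xⁿ-1 α
mainTheorem8 zero β () _
mainTheorem8 (suc a) zero _ ()
mainTheorem8 (suc a) (suc k) _ _ b ℓ f g h (_ , _ , _ , _ , _ , _ , _ , b∣Φ , _)
             b̄ ℓ̄ f̄ ḡ h̄ std̄@(_ , _ , _ , _ , _ , _ , _ , b̄∣Φ , _) dual d gcd@(d∣b , _) =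
  ~⇒≈ (begin
    b̄ ⊛ (d *)  ≈⟨ ⊛-congˡ (d *) (~-sym D≈b̄) ⟩
    D ⊛ (d *)  ≈⟨ D·d*≈Φ ⟩
    Φ (suc a)  ∎)
  where
  open Binary
  open Duality.Proof a k b ℓ f h b̄ ℓ̄ f̄ h̄ dual d gcd
  open SR ~-setoid
  -- x^α - 1 = c̄·b̄, and x^α - 1 = e·d because d ∣ b ∣ x^α - 1
  c̄ e : Pol
  c̄ = proj₁ (∣⇒∣~ {b̄} {Φ (suc a)} b̄∣Φ)
  e = proj₁ (∣~-trans (∣⇒∣~ {d} {b} d∣b) (∣⇒∣~ {b} {Φ (suc a)} b∣Φ))
  Φ≈c̄b̄ : Φ (suc a) ~ c̄ ⊛ b̄
  Φ≈c̄b̄ = proj₂ (∣⇒∣~ {b̄} {Φ (suc a)} b̄∣Φ)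
  Φ≈ed : Φ (suc a) ~ e ⊛ d
  Φ≈ed = proj₂ (∣~-trans (∣⇒∣~ {d} {b} d∣b) (∣⇒∣~ {b} {Φ (suc a)} b∣Φ))
  -- the reciprocal cofactor D = e* of d gives a binary word (D | 0) of C̄ = C^⊥
  D : Pol
  D = e *
  D·d*≈Φ : D ⊛ (d *) ~ Φ (suc a)
  D·d*≈Φ = reciprocal-factorisation a e d Φ≈ed
  b̄∣D : b̄ ∣~ D
  b̄∣D = 𝒞̄.binaryWord⇒multiple ḡ std̄ D (reciprocal-cofactor∈dual D D·d*≈Φ)
  c̄*∣d : (c̄ *) ∣~ d
  c̄*∣d = cofactor*∣gcd c̄ Φ≈c̄b̄
  D≈b̄ : D ~ b̄
  D≈b̄ = factorisation-rigid a c̄ b̄ D d (proj₁ b̄∣D) (proj₁ c̄*∣d) Φ≈c̄b̄ D·d*≈Φ (proj₂ b̄∣D) (proj₂ c̄*∣d)
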